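{- Let $\overline S$ be the set of lattice points in the rectangle $[-a,a]\times[-b,b]$ for some $a,b\in \mathbb Z_{>0}$. Let $S$ be obtained by removing the vector $0$ and taking only one copy of each $\pm \mathbf{v}$ in $\overline S$. Then, the following are equivalent: \begin{enumerate} \item $S$ satisfies the Lonely Vector Property. \item At least one of the vectors $(2a-1,2b)$ or $(2a,2b-1)$ is primitive. \end{enumerate}
   Context: For a vector configuration $S$, let $D(S)$ be the multiset containing $2\mathbf{u}$ for each $\mathbf{u}\in S$ and, for each unordered pair $\{\mathbf{u},\mathbf{v}\}$ of distinct elements of $S$, the vector $\mathbf{u}+\mathbf{v}$ and one of $\mathbf{u}-\mathbf{v}$, $\mathbf{v}-\mathbf{u}$. $S$ has the Lonely Vector Property if $D(S)$ contains an element that is not proportional to any other element of $D(S)$. A lattice vector is primitive if the segment from the origin to it contains no lattice points other than its endpoints. -}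

module Defs where

open import Data.Nat using (ℕ) renaming (_<_ to _<ℕ_)
open import Data.Integer using (ℤ; +_; _+_; _-_; _*_; -_; _≤_; _<_)
open import Data.Product using (_×_; _,_; Σ; ∃)
open import Data.Sum using (_⊎_)
open import Data.List using (List; []; _∷_; _++_; concatMap; length; lookup)
open import Data.List.Membership.Propositional using (_∈_)
open import Data.List.Relation.Unary.Unique.Propositional using (Unique)
open import Data.Fin using (Fin)
open import Relation.Binary.PropositionalEquality using (_≡_; _≢_)
open import Relation.Nullary using (¬_)

V : Set
V = ℤ × ℤ

infixl 6 _⊕_ _⊖_
_⊕_ : V → V → V
(x , y) ⊕ (x' , y') = (x + x' , y + y')

_⊖_ : V → V → V
(x , y) ⊖ (x' , y') = (x - x' , y - y')

neg : V → V
neg (x , y) = (- x , - y)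

_·_ : ℤ → V → V
c · (x , y) = (c * x , c * y)

zeroV : V
zeroV = (+ 0 , + 0)

-- u and v are proportional: a nontrivial linear relation λ u = μ v
-- (over ℚ, equivalently over ℤ after clearing denominators).
Proportional : V → V → Set
Proportional u v =
  Σ ℤ λ l → Σ ℤ λ m → ((l ≢ + 0) ⊎ (m ≢ + 0)) × (l · u ≡ m · v)

-- The multiset D(S), for S given as a list (multiset) of vectors:
-- 2u for each u, and for each pair (u before v in the list) u+v and u-v.
-- (The choice of u-v versus v-u is irrelevant for proportionality.)
D : List V → List V
D [] = []
D (u ∷ S) = ((+ 2) · u) ∷ (concatMap (λ v → (u ⊕ v) ∷ (u ⊖ v) ∷ []) S ++ D S)

LonelyVectorProperty : List V → Set
LonelyVectorProperty S =
  Σ (Fin (length (D S))) λ i → ∀ (j : Fin (length (D S))) → i ≢ j →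
    ¬ Proportional (lookup (D S) i) (lookup (D S) j)

-- Primitive lattice vector: the closed segment from 0 to v contains no
-- lattice points other than its endpoints; i.e. there is no lattice
-- point p = (k/n) v with 0 < k < n.
Primitive : V → Set
Primitive v = ∀ (p : V) (k n : ℕ) → 0 <ℕ k → k <ℕ n →
  ¬ ((+ n) · p ≡ (+ k) · v)

InRect : ℕ → ℕ → V → Set
InRect a b (x , y) = (- (+ a) ≤ x × x ≤ + a) × (- (+ b) ≤ y × y ≤ + b)

IsHalfRect : ℕ → ℕ → List V → Set
IsHalfRect a b S =
  Unique S
  × (∀ v → v ∈ S → InRect a b v × v ≢ zeroV)
  × (∀ v → InRect a b v → v ≢ zeroV → (v ∈ S ⊎ neg v ∈ S))
  × (∀ v → v ∈ S → ¬ (neg v ∈ S))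

-- Write ±v for {v, -v}. S holds one representative of ±p for every nonzero point p of the
-- rectangle R = [-a, a] × [-b, b], so every splitting z = p + q with p, q ∈ R, p ≠ ±q puts an
-- element of ±z into D(S) (one of u + v, u - v for the representatives u, v of ±p, ±q), and the
-- size of ±z ∩ D(S) can be counted through such splittings. For w = (2a - 1, 2b) the only
-- splitting is (a, b) + (a - 1, b) and 2u ≠ ±w by parity, so ±w occurs exactly once in D(S);
-- all of D(S) lies in 2R, so if w is primitive nothing else in D(S) is proportional to it.
-- Conversely a lonely z ∈ D(S) is primitive (else some rz with 0 < r ≤ 1/2 lies in R, hence in
-- D(S) up to sign), is not in R (else ±2z ∈ D(S)), and unless (|x|, |y|) is (2a - 1, 2b) or
-- (2a, 2b - 1) it has two different splittings, so ±z occurs twice.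

module Submission where

open import Defs
open import Data.Nat as ℕ using (ℕ; _<_; zero; suc; z≤n; s≤s)
import Data.Nat.Properties as ℕP
open import Data.Nat.Tactic.RingSolver using () renaming (solve-∀ to solveℕ-∀)
open import Algebra.Properties.CommutativeSemigroup ℕP.+-commutativeSemigroup using (interchange)
open import Data.Integer as ℤ using (ℤ; +_; -[1+_]; _+_; _-_; _*_; -_; ∣_∣; _≤_; +≤+; -≤+; -≤-)
import Data.Integer.Properties as ℤP
open import Data.Integer.Tactic.RingSolver using (solve-∀)
open import Data.Product using (_,_; _×_; Σ; proj₁; proj₂)
open import Data.Product.Properties using (≡-dec)
open import Data.Sum as Sum using (_⊎_; inj₁; inj₂)
open import Data.List using (List; []; _∷_; _++_; concatMap; length; lookup; map)
open import Data.List.Properties using (map-++)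
open import Data.List.Membership.Propositional using (_∈_; _∉_)
open import Data.List.Membership.Propositional.Properties using (∈-map⁺; ∈-map⁻; ∈-lookup)
open import Data.List.Relation.Unary.Any using (here; there)
open import Data.List.Relation.Unary.All as All using (All; []; _∷_)
open import Data.List.Relation.Unary.All.Properties using (++⁺)
open import Data.List.Relation.Unary.AllPairs using ([]; _∷_)
open import Data.List.Relation.Unary.Unique.Propositional using (Unique)
open import Data.List.Relation.Unary.Unique.Propositional.Properties using (map⁺)
open import Data.Fin using (Fin; zero; suc)
import Data.Fin.Properties as FinP
open import Data.Empty using (⊥; ⊥-elim)
open import Data.Unit using (⊤)
open import Function.Base using (_∘_; id)
open import Function.Bundles using (_⇔_; mk⇔)
open import Relation.Nullary using (¬_; Dec; yes; no)
open import Relation.Binary.PropositionalEquality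

module _ {A : Set} where

  sumBy : (A → ℕ) → List A → ℕ
  sumBy f []       = 0
  sumBy f (x ∷ xs) = f x ℕ.+ sumBy f xs

  pairSum : (A → A → ℕ) → List A → ℕ
  pairSum h []       = 0
  pairSum h (x ∷ xs) = sumBy (h x) xs ℕ.+ pairSum h xs

  sumBy-++ : ∀ f xs ys → sumBy f (xs ++ ys) ≡ sumBy f xs ℕ.+ sumBy f ys
  sumBy-++ f []       ys = refl
  sumBy-++ f (x ∷ xs) ys = trans (cong (f x ℕ.+_) (sumBy-++ f xs ys)) (sym (ℕP.+-assoc (f x) _ _))

  sumBy-cong : ∀ {f g} xs → (∀ x → f x ≡ g x) → sumBy f xs ≡ sumBy g xs
  sumBy-cong []       f≗g = refl
  sumBy-cong (x ∷ xs) f≗g = cong₂ ℕ._+_ (f≗g x) (sumBy-cong xs f≗g)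

  sumBy-+ : ∀ f g xs → sumBy (λ x → f x ℕ.+ g x) xs ≡ sumBy f xs ℕ.+ sumBy g xs
  sumBy-+ f g []       = refl
  sumBy-+ f g (x ∷ xs) =
    trans (cong (f x ℕ.+ g x ℕ.+_) (sumBy-+ f g xs)) (interchange (f x) (g x) _ _)

  sumBy-*ˡ : ∀ k f xs → sumBy (λ x → k ℕ.* f x) xs ≡ k ℕ.* sumBy f xs
  sumBy-*ˡ k f []       = sym (ℕP.*-zeroʳ k)
  sumBy-*ˡ k f (x ∷ xs) =
    trans (cong (k ℕ.* f x ℕ.+_) (sumBy-*ˡ k f xs)) (sym (ℕP.*-distribˡ-+ k (f x) _))

  sumBy-zero : ∀ {f} xs → (∀ x → f x ≡ 0) → sumBy f xs ≡ 0
  sumBy-zero {f} []       f≗0 = refl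
  sumBy-zero {f} (x ∷ xs) f≗0 = trans (cong (ℕ._+ sumBy f xs) (f≗0 x)) (sumBy-zero xs f≗0)

  ≤-sumBy : ∀ f {x} xs → x ∈ xs → f x ℕ.≤ sumBy f xs
  ≤-sumBy f (y ∷ xs) (here refl) = ℕP.m≤m+n (f y) _
  ≤-sumBy f (y ∷ xs) (there x∈) = ℕP.≤-trans (≤-sumBy f xs x∈) (ℕP.m≤n+m _ (f y))

  pairSum-mono-All : ∀ {h₁ h₂ : A → A → ℕ} (P : A → Set) xs → All P xs →
    (∀ x y → P x → P y → h₁ x y ℕ.≤ h₂ x y) → pairSum h₁ xs ℕ.≤ pairSum h₂ xs
  pairSum-mono-All P []       _          _   = z≤n
  pairSum-mono-All {h₁} {h₂} P (x ∷ xs) (px ∷ pxs) h₁≤h₂ =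
    ℕP.+-mono-≤ (row xs pxs) (pairSum-mono-All P xs pxs h₁≤h₂)
    where
    row : ∀ ys → All P ys → sumBy (h₁ x) ys ℕ.≤ sumBy (h₂ x) ys
    row []       _          = z≤n
    row (y ∷ ys) (py ∷ pys) = ℕP.+-mono-≤ (h₁≤h₂ x y px py) (row ys pys)

  pairSum-mono : ∀ {h₁ h₂ : A → A → ℕ} xs → (∀ x y → h₁ x y ℕ.≤ h₂ x y) → pairSum h₁ xs ℕ.≤ pairSum h₂ xs
  pairSum-mono xs h₁≤h₂ = pairSum-mono-All (λ _ → ⊤) xs (All.universal _ xs) (λ x y _ _ → h₁≤h₂ x y)

  pairSum-+ : ∀ h₁ h₂ xs → pairSum (λ x y → h₁ x y ℕ.+ h₂ x y) xs ≡ pairSum h₁ xs ℕ.+ pairSum h₂ xs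
  pairSum-+ h₁ h₂ []       = refl
  pairSum-+ h₁ h₂ (x ∷ xs) =
    trans (cong₂ ℕ._+_ (sumBy-+ (h₁ x) (h₂ x) xs) (pairSum-+ h₁ h₂ xs))
          (interchange (sumBy (h₁ x) xs) (sumBy (h₂ x) xs) (pairSum h₁ xs) (pairSum h₂ xs))

indicator : ∀ {P : Set} → Dec P → ℕ
indicator (yes _) = 1
indicator (no _)  = 0

indicator-yes : ∀ {P : Set} (d : Dec P) → P → indicator d ≡ 1
indicator-yes (yes _) _ = refl
indicator-yes (no ¬p) p = ⊥-elim (¬p p)

indicator-no : ∀ {P : Set} (d : Dec P) → ¬ P → indicator d ≡ 0
indicator-no (yes p) ¬p = ⊥-elim (¬p p)
indicator-no (no _)  _  = refl

indicator-cong : ∀ {P Q : Set} → (P → Q) → (Q → P) → (d : Dec P) (e : Dec Q) → indicator d ≡ indicator e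
indicator-cong f g (yes p) (yes q) = refl
indicator-cong f g (yes p) (no ¬q) = ⊥-elim (¬q (f p))
indicator-cong f g (no ¬p) (yes q) = ⊥-elim (¬p (g q))
indicator-cong f g (no ¬p) (no ¬q) = refl

indicator-+-pos : ∀ {P Q : Set} (d : Dec P) (e : Dec Q) → P ⊎ Q → 1 ℕ.≤ indicator d ℕ.+ indicator e
indicator-+-pos (yes _) e  _        = s≤s z≤n
indicator-+-pos (no _) (yes _) _    = s≤s z≤n
indicator-+-pos (no ¬p) (no _) (inj₁ p) = ⊥-elim (¬p p)
indicator-+-pos (no _) (no ¬q) (inj₂ q) = ⊥-elim (¬q q)

indicator-+-≤ : ∀ {P Q : Set} (d : Dec P) (e : Dec Q) n → (P → Q → ⊥) → (P ⊎ Q → 1 ℕ.≤ n) →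
  indicator d ℕ.+ indicator e ℕ.≤ n
indicator-+-≤ (yes p) (yes q) n excl pos = ⊥-elim (excl p q)
indicator-+-≤ (yes p) (no _)  n excl pos = pos (inj₁ p)
indicator-+-≤ (no _)  (yes q) n excl pos = pos (inj₂ q)
indicator-+-≤ (no _)  (no _)  n excl pos = z≤n

indicator-*-excl : ∀ {P Q : Set} (d : Dec P) (e : Dec Q) → (P → Q → ⊥) → indicator d ℕ.* indicator e ≡ 0
indicator-*-excl (yes p) (yes q) excl = ⊥-elim (excl p q)
indicator-*-excl (yes _) (no _)  excl = refl
indicator-*-excl (no _)  e       excl = refl

indicator-pair-cases : ∀ {P Q R T : Set} (p : Dec P) (q : Dec Q) (r : Dec R) (t : Dec T) →
  (P → R → ⊥) → (Q → T → ⊥) →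
  let n = indicator p ℕ.* indicator q ℕ.+ indicator r ℕ.* indicator t in
  n ≡ 0 ⊎ (n ≡ 1 × ((P × Q) ⊎ (R × T)))
indicator-pair-cases (yes p) (yes q) (yes r) _       excl₁ excl₂ = ⊥-elim (excl₁ p r)
indicator-pair-cases (yes p) (yes q) (no _)  _       excl₁ excl₂ = inj₂ (refl , inj₁ (p , q))
indicator-pair-cases (yes p) (no _)  (yes r) _       excl₁ excl₂ = ⊥-elim (excl₁ p r)
indicator-pair-cases (yes p) (no _)  (no _)  _       excl₁ excl₂ = inj₁ refl
indicator-pair-cases (no _)  (yes q) (yes r) (yes t) excl₁ excl₂ = ⊥-elim (excl₂ q t)
indicator-pair-cases (no _)  (no _)  (yes r) (yes t) excl₁ excl₂ = inj₂ (refl , inj₂ (r , t))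
indicator-pair-cases (no _)  _       (yes r) (no _)  excl₁ excl₂ = inj₁ refl
indicator-pair-cases (no _)  _       (no _)  _       excl₁ excl₂ = inj₁ refl

indicator-pair-pos : ∀ {P Q R T : Set} (p : Dec P) (q : Dec Q) (r : Dec R) (t : Dec T) →
  (P × Q) ⊎ (R × T) → 1 ℕ.≤ indicator p ℕ.* indicator q ℕ.+ indicator r ℕ.* indicator t
indicator-pair-pos p q r t (inj₁ (x , y)) rewrite indicator-yes p x | indicator-yes q y = s≤s z≤n
indicator-pair-pos p q r t (inj₂ (x , y)) rewrite indicator-yes r x | indicator-yes t y =
  ℕP.m≤n+m 1 (indicator p ℕ.* indicator q)

_≟ᵥ_ : (u v : V) → Dec (u ≡ v)
_≟ᵥ_ = ≡-dec ℤ._≟_ ℤ._≟_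

neg-involutive : ∀ v → neg (neg v) ≡ v
neg-involutive (x , y) = cong₂ _,_ (ℤP.neg-involutive x) (ℤP.neg-involutive y)

neg-injective : ∀ {u v} → neg u ≡ neg v → u ≡ v
neg-injective {u} {v} eq = trans (sym (neg-involutive u)) (trans (cong neg eq) (neg-involutive v))

neg-swap : ∀ {u v} → neg u ≡ v → u ≡ neg v
neg-swap {u} refl = sym (neg-involutive u)

⊕-comm : ∀ u v → u ⊕ v ≡ v ⊕ u
⊕-comm (x , y) (x' , y') = cong₂ _,_ (ℤP.+-comm x x') (ℤP.+-comm y y')

neg-distrib-⊕ : ∀ u v → neg (u ⊕ v) ≡ neg u ⊕ neg v
neg-distrib-⊕ (x , y) (x' , y') = cong₂ _,_ (ℤP.neg-distrib-+ x x') (ℤP.neg-distrib-+ y y')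

neg-distrib-⊖ : ∀ u v → neg (u ⊖ v) ≡ neg u ⊖ neg v
neg-distrib-⊖ (x , y) (x' , y') = cong₂ _,_ (ℤP.neg-distrib-+ x (- x')) (ℤP.neg-distrib-+ y (- y'))

⊖-neg : ∀ u v → u ⊖ neg v ≡ u ⊕ v
⊖-neg (x , y) (x' , y') = cong₂ _,_ (cong (ℤ._+_ x) (ℤP.neg-involutive x')) (cong (ℤ._+_ y) (ℤP.neg-involutive y'))

neg-· : ∀ c v → neg (c · v) ≡ c · neg v
neg-· c (x , y) = cong₂ _,_ (ℤP.neg-distribʳ-* c x) (ℤP.neg-distribʳ-* c y)

·-neg : ∀ c v → c · neg v ≡ (- c) · v
·-neg c (x , y) = cong₂ _,_ (lemma x) (lemma y)
  where
  lemma : ∀ x → c * - x ≡ - c * x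
  lemma x = trans (sym (ℤP.neg-distribʳ-* c x)) (ℤP.neg-distribˡ-* c x)

·-identityˡ : ∀ v → (+ 1) · v ≡ v
·-identityˡ (x , y) = cong₂ _,_ (ℤP.*-identityˡ x) (ℤP.*-identityˡ y)

⊕-self : ∀ u → u ⊕ u ≡ (+ 2) · u
⊕-self (x , y) = cong₂ _,_ (lemma x) (lemma y)
  where
  lemma : ∀ x → x + x ≡ + 2 * x
  lemma = solve-∀

⊖≡zero⇒≡ : ∀ u v → u ⊖ v ≡ zeroV → u ≡ v
⊖≡zero⇒≡ (x , y) (x' , y') eq =
  cong₂ _,_ (ℤP.i-j≡0⇒i≡j x x' (cong proj₁ eq)) (ℤP.i-j≡0⇒i≡j y y' (cong proj₂ eq))

⊕≡zero⇒≡neg : ∀ u v → u ⊕ v ≡ zeroV → v ≡ neg u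
⊕≡zero⇒≡neg u v eq = neg-swap (sym (⊖≡zero⇒≡ u (neg v) (trans (⊖-neg u v) eq)))

≡-neg⇒zero : ∀ x → x ≡ - x → x ≡ + 0
≡-neg⇒zero (+ zero)  _ = refl
≡-neg⇒zero (+ suc n) ()
≡-neg⇒zero -[1+ n ]  ()

nonzero⇒≢neg : ∀ v → v ≢ zeroV → v ≢ neg v
nonzero⇒≢neg (x , y) v≢0 eq =
  v≢0 (cong₂ _,_ (≡-neg⇒zero x (cong proj₁ eq)) (≡-neg⇒zero y (cong proj₂ eq)))

infix 4 _≡±_ _≟±_

_≡±_ : V → V → Set
v ≡± c = v ≡ c ⊎ v ≡ neg c

_≟±_ : (v c : V) → Dec (v ≡± c)
v ≟± c with v ≟ᵥ c | v ≟ᵥ neg c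
... | yes p | _     = yes (inj₁ p)
... | no _  | yes q = yes (inj₂ q)
... | no p  | no q  = no λ { (inj₁ x) → p x ; (inj₂ x) → q x }

Disjoint± : V → V → Set
Disjoint± c d = ∀ v → v ≡± c → v ≡± d → ⊥

disjoint± : ∀ c d → c ≢ d → c ≢ neg d → Disjoint± c d
disjoint± c d c≢d c≢-d v (inj₁ refl) (inj₁ eq) = c≢d eq
disjoint± c d c≢d c≢-d v (inj₁ refl) (inj₂ eq) = c≢-d eq
disjoint± c d c≢d c≢-d v (inj₂ refl) (inj₁ eq) = c≢-d (neg-swap eq)
disjoint± c d c≢d c≢-d v (inj₂ refl) (inj₂ eq) = c≢d (neg-injective eq)

count± : V → List V → ℕ
count± c L = sumBy (λ v → indicator (v ≟± c)) L

count±-split : ∀ c L → c ≢ neg c →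
  count± c L ≡ sumBy (λ v → indicator (v ≟ᵥ c)) L ℕ.+ sumBy (λ v → indicator (v ≟ᵥ neg c)) L
count±-split c L c≢-c = trans (sumBy-cong L split) (sumBy-+ _ _ L)
  where
  split : ∀ v → indicator (v ≟± c) ≡ indicator (v ≟ᵥ c) ℕ.+ indicator (v ≟ᵥ neg c)
  split v with v ≟ᵥ c | v ≟ᵥ neg c
  ... | yes refl | yes q = ⊥-elim (c≢-c q)
  ... | yes _    | no _  = refl
  ... | no _     | yes _ = refl
  ... | no _     | no _  = refl

count-∉ : ∀ x L → x ∉ L → sumBy (λ v → indicator (v ≟ᵥ x)) L ≡ 0
count-∉ x []      _   = refl
count-∉ x (y ∷ L) x∉ with y ≟ᵥ x
... | yes refl = ⊥-elim (x∉ (here refl))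
... | no _     = count-∉ x L (λ x∈ → x∉ (there x∈))

count-∈-unique : ∀ x L → Unique L → x ∈ L → sumBy (λ v → indicator (v ≟ᵥ x)) L ≡ 1
count-∈-unique x (y ∷ L) (y∉ ∷ _) (here refl) with y ≟ᵥ y
... | yes _  = cong suc (count-∉ y L (λ y∈ → All.lookup y∉ y∈ refl))
... | no y≢y = ⊥-elim (y≢y refl)
count-∈-unique x (y ∷ L) (y∉ ∷ unique) (there x∈) with y ≟ᵥ x
... | yes refl = ⊥-elim (All.lookup y∉ x∈ refl)
... | no _     = count-∈-unique x L unique x∈

count±-halfRect : ∀ {a b S} → IsHalfRect a b S → ∀ c → InRect a b c → c ≢ zeroV → count± c S ≡ 1
count±-halfRect {a} {b} {S} (unique , _ , covers , antipodal) c c∈ c≢0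
  rewrite count±-split c S (nonzero⇒≢neg c c≢0) with covers c c∈ c≢0
... | inj₁ c∈S  = cong₂ ℕ._+_ (count-∈-unique c S unique c∈S) (count-∉ (neg c) S (antipodal c c∈S))
... | inj₂ -c∈S = cong₂ ℕ._+_ (count-∉ c S (λ c∈S → antipodal c c∈S -c∈S)) (count-∈-unique (neg c) S unique -c∈S)

-- Counting in D(S)

doubleHit : V → V → ℕ
doubleHit z u = indicator ((+ 2) · u ≟± z)

sumDiffHits : V → V → V → ℕ
sumDiffHits z u v = indicator (u ⊕ v ≟± z) ℕ.+ indicator (u ⊖ v ≟± z)

count±-D : ∀ z S → count± z (D S) ≡ sumBy (doubleHit z) S ℕ.+ pairSum (sumDiffHits z) S
count±-D z []      = refl
count±-D z (u ∷ S) = begin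
    doubleHit z u ℕ.+ count± z (row S ++ D S)
  ≡⟨ cong (doubleHit z u ℕ.+_) (sumBy-++ _ (row S) (D S)) ⟩
    doubleHit z u ℕ.+ (count± z (row S) ℕ.+ count± z (D S))
  ≡⟨ cong₂ (λ m n → doubleHit z u ℕ.+ (m ℕ.+ n)) (count±-row S) (count±-D z S) ⟩
    doubleHit z u ℕ.+ (sumBy (sumDiffHits z u) S ℕ.+ (sumBy (doubleHit z) S ℕ.+ pairSum (sumDiffHits z) S))
  ≡⟨ sym (ℕP.+-assoc (doubleHit z u) _ _) ⟩
    (doubleHit z u ℕ.+ sumBy (sumDiffHits z u) S) ℕ.+ (sumBy (doubleHit z) S ℕ.+ pairSum (sumDiffHits z) S)
  ≡⟨ interchange (doubleHit z u) _ _ _ ⟩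
    (doubleHit z u ℕ.+ sumBy (doubleHit z) S) ℕ.+ (sumBy (sumDiffHits z u) S ℕ.+ pairSum (sumDiffHits z) S) ∎
  where
  open ≡-Reasoning
  row : List V → List V
  row = concatMap (λ v → (u ⊕ v) ∷ (u ⊖ v) ∷ [])
  count±-row : ∀ T → count± z (row T) ≡ sumBy (sumDiffHits z u) T
  count±-row []      = refl
  count±-row (v ∷ T) = trans (cong (λ n → indicator (u ⊕ v ≟± z) ℕ.+ (indicator (u ⊖ v ≟± z) ℕ.+ n)) (count±-row T))
                             (sym (ℕP.+-assoc (indicator (u ⊕ v ≟± z)) _ _))

sumDiffHits≤count±-D : ∀ z S → pairSum (sumDiffHits z) S ℕ.≤ count± z (D S)
sumDiffHits≤count±-D z S rewrite count±-D z S = ℕP.m≤n+m _ _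

doubleHits≤count±-D : ∀ z S → sumBy (doubleHit z) S ℕ.≤ count± z (D S)
doubleHits≤count±-D z S rewrite count±-D z S = ℕP.m≤m+n _ _

hitsPair : V → V → V → V → ℕ
hitsPair c d u v = indicator (u ≟± c) ℕ.* indicator (v ≟± d) ℕ.+ indicator (u ≟± d) ℕ.* indicator (v ≟± c)

HitsPair : V → V → V → V → Set
HitsPair c d u v = (u ≡± c × v ≡± d) ⊎ (u ≡± d × v ≡± c)

hitsPair-cases : ∀ {c d} → Disjoint± c d → ∀ u v →
  hitsPair c d u v ≡ 0 ⊎ (hitsPair c d u v ≡ 1 × HitsPair c d u v)
hitsPair-cases {c} {d} disj u v =
  indicator-pair-cases (u ≟± c) (v ≟± d) (u ≟± d) (v ≟± c) (disj u) (λ v≡±d v≡±c → disj v v≡±c v≡±d)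

HitsPair⇒hitsPair-pos : ∀ c d u v → HitsPair c d u v → 1 ℕ.≤ hitsPair c d u v
HitsPair⇒hitsPair-pos c d u v = indicator-pair-pos (u ≟± c) (v ≟± d) (u ≟± d) (v ≟± c)

pairSum-hitsPair : ∀ {c d} → Disjoint± c d → ∀ S → pairSum (hitsPair c d) S ≡ count± c S ℕ.* count± d S
pairSum-hitsPair         disj []      = refl
pairSum-hitsPair {c} {d} disj (u ∷ S) = begin
    sumBy (hitsPair c d u) S ℕ.+ pairSum (hitsPair c d) S
  ≡⟨ cong₂ ℕ._+_ row (pairSum-hitsPair disj S) ⟩
    (x ℕ.* Y ℕ.+ y ℕ.* X) ℕ.+ X ℕ.* Y
  ≡⟨ cong (ℕ._+ ((x ℕ.* Y ℕ.+ y ℕ.* X) ℕ.+ X ℕ.* Y)) (sym (indicator-*-excl (u ≟± c) (u ≟± d) (disj u))) ⟩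
    x ℕ.* y ℕ.+ ((x ℕ.* Y ℕ.+ y ℕ.* X) ℕ.+ X ℕ.* Y)
  ≡⟨ expand x y X Y ⟩
    (x ℕ.+ X) ℕ.* (y ℕ.+ Y) ∎
  where
  open ≡-Reasoning
  x = indicator (u ≟± c)
  y = indicator (u ≟± d)
  X = count± c S
  Y = count± d S
  row : sumBy (hitsPair c d u) S ≡ x ℕ.* Y ℕ.+ y ℕ.* X
  row = trans (sumBy-+ _ _ S) (cong₂ ℕ._+_ (sumBy-*ˡ x _ S) (sumBy-*ˡ y _ S))
  expand : ∀ x y X Y → x ℕ.* y ℕ.+ ((x ℕ.* Y ℕ.+ y ℕ.* X) ℕ.+ X ℕ.* Y) ≡ (x ℕ.+ X) ℕ.* (y ℕ.+ Y)
  expand = solveℕ-∀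

index-of-count± : ∀ z L → 1 ℕ.≤ count± z L → Σ (Fin (length L)) λ j → lookup L j ≡± z
index-of-count± z (x ∷ L) pos with x ≟± z
... | yes x≡±z = zero , x≡±z
... | no _     = let (j , p) = index-of-count± z L pos in suc j , p

other-index-of-count± : ∀ z L (i : Fin (length L)) → lookup L i ≡± z → 2 ℕ.≤ count± z L →
  Σ (Fin (length L)) λ j → j ≢ i × lookup L j ≡± z
other-index-of-count± z (x ∷ L) zero x≡±z two≤ with x ≟± z
... | yes _  = let (j , p) = index-of-count± z L (ℕP.≤-pred two≤) in suc j , (λ ()) , p
... | no x≢± = ⊥-elim (x≢± x≡±z)
other-index-of-count± z (x ∷ L) (suc i) Li≡±z two≤ with x ≟± z
... | yes x≡±z = zero , (λ ()) , x≡±z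
... | no _     =
  let (j , j≢i , p) = other-index-of-count± z L i Li≡±z two≤ in suc j , (λ eq → j≢i (FinP.suc-injective eq)) , p

absent-of-count± : ∀ z L → count± z L ≡ 0 → ∀ j → ¬ lookup L j ≡± z
absent-of-count± z (x ∷ L) none j with x ≟± z | none
... | yes _  | ()
... | no x≢± | none' with j
...   | zero   = x≢±
...   | suc j' = absent-of-count± z L none' j'

unique-index-of-count± : ∀ z L → count± z L ≡ 1 →
  Σ (Fin (length L)) λ i → lookup L i ≡± z × (∀ j → j ≢ i → ¬ lookup L j ≡± z)
unique-index-of-count± z (x ∷ L) one with x ≟± z | one
... | yes x≡±z | one' = zero , x≡±z , λ
  { zero j≢0 → ⊥-elim (j≢0 refl)
  ; (suc j) _ → absent-of-count± z L (ℕP.suc-injective one') j }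
... | no x≢±   | one' =
  let (i , p , others) = unique-index-of-count± z L one' in
  suc i , p , λ { zero _ → x≢± ; (suc j) j≢i → others j (λ eq → j≢i (cong suc eq)) }

-≢0 : ∀ m → m ≢ + 0 → - m ≢ + 0
-≢0 m m≢0 eq = m≢0 (trans (sym (ℤP.neg-involutive m)) (cong -_ eq))

proportional-negʳ : ∀ u v → Proportional u v → Proportional u (neg v)
proportional-negʳ u v (l , m , nontrivial , eq) =
  l , - m , Sum.map₂ (-≢0 m) nontrivial ,
  trans eq (sym (trans (·-neg (- m) v) (cong (_· v) (ℤP.neg-involutive m))))

proportional-negˡ : ∀ u v → Proportional (neg u) v → Proportional u v
proportional-negˡ u v (l , m , nontrivial , eq) =
  - l , m , Sum.map₁ (-≢0 l) nontrivial , trans (sym (·-neg l u)) eq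

proportional-≡±ʳ : ∀ {z r w} → Proportional z r → w ≡± r → Proportional z w
proportional-≡±ʳ         p (inj₁ refl) = p
proportional-≡±ʳ {z} {r} p (inj₂ refl) = proportional-negʳ z r p

proportional-≡±ˡ : ∀ {w z z'} → z ≡± w → Proportional z z' → Proportional w z'
proportional-≡±ˡ              (inj₁ refl) p = p
proportional-≡±ˡ {w} {z} {z'} (inj₂ refl) p = proportional-negˡ w z' p

≡±⇒proportional : ∀ {z w} → w ≡± z → Proportional z w
≡±⇒proportional = proportional-≡±ʳ (+ 1 , + 1 , inj₁ (λ ()) , refl)

IsLonely : (L : List V) → Fin (length L) → Set
IsLonely L i = ∀ j → i ≢ j → ¬ Proportional (lookup L i) (lookup L j)

lonely⇒proportional-class-absent : ∀ L i → IsLonely L i → ∀ r → ¬ lookup L i ≡± r →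
  Proportional (lookup L i) r → ¬ 1 ℕ.≤ count± r L
lonely⇒proportional-class-absent L i lonely r Li≢±r prop pos =
  let (j , Lj≡±r) = index-of-count± r L pos in
  lonely j (λ { refl → Li≢±r Lj≡±r }) (proportional-≡±ʳ prop Lj≡±r)

lonely⇒count±<2 : ∀ L i → IsLonely L i → ¬ 2 ℕ.≤ count± (lookup L i) L
lonely⇒count±<2 L i lonely two≤ =
  let (j , j≢i , Lj≡±Li) = other-index-of-count± (lookup L i) L i (inj₁ refl) two≤ in
  lonely j (λ i≡j → j≢i (sym i≡j)) (≡±⇒proportional Lj≡±Li)

unique-class⇒lonely : ∀ w L → count± w L ≡ 1 → (∀ j → Proportional w (lookup L j) → lookup L j ≡± w) →
  Σ (Fin (length L)) (IsLonely L)
unique-class⇒lonely w L one closed =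
  let (i , Li≡±w , others) = unique-index-of-count± w L one in
  i , λ j i≢j prop → others j (λ j≡i → i≢j (sym j≡i)) (closed j (proportional-≡±ˡ Li≡±w prop))

-- Decompositions z = p + q into points of the rectangle

RectPoint : ℕ → ℕ → V → Set
RectPoint a b v = InRect a b v × v ≢ zeroV

aligned-sumDiffHit : ∀ {p q u v} → u ≡± p → v ≡± q → u ⊕ v ≡± p ⊕ q ⊎ u ⊖ v ≡± p ⊕ q
aligned-sumDiffHit         (inj₁ refl) (inj₁ refl) = inj₁ (inj₁ refl)
aligned-sumDiffHit {p} {q} (inj₁ refl) (inj₂ refl) = inj₂ (inj₁ (⊖-neg p q))
aligned-sumDiffHit {p} {q} (inj₂ refl) (inj₁ refl) = inj₂ (inj₂ (sym (neg-distrib-⊕ p q)))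
aligned-sumDiffHit {p} {q} (inj₂ refl) (inj₂ refl) = inj₁ (inj₂ (sym (neg-distrib-⊕ p q)))

HitsPair⇒sumDiffHit : ∀ {p q z u v} → p ⊕ q ≡ z → HitsPair p q u v → u ⊕ v ≡± z ⊎ u ⊖ v ≡± z
HitsPair⇒sumDiffHit {u = u} {v} refl (inj₁ (u≡±p , v≡±q)) = aligned-sumDiffHit u≡±p v≡±q
HitsPair⇒sumDiffHit {p} {q} {u = u} {v} refl (inj₂ (u≡±q , v≡±p)) =
  subst (λ w → u ⊕ v ≡± w ⊎ u ⊖ v ≡± w) (⊕-comm q p) (aligned-sumDiffHit u≡±q v≡±p)

sumDiffHits-pos : ∀ z u v → u ⊕ v ≡± z ⊎ u ⊖ v ≡± z → 1 ℕ.≤ sumDiffHits z u v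
sumDiffHits-pos z u v = indicator-+-pos (u ⊕ v ≟± z) (u ⊖ v ≟± z)

hitsPair≤sumDiffHits : ∀ {p q z} → p ⊕ q ≡ z → Disjoint± p q → ∀ u v → hitsPair p q u v ℕ.≤ sumDiffHits z u v
hitsPair≤sumDiffHits {z = z} p+q≡z disj u v with hitsPair-cases disj u v
... | inj₁ none         rewrite none = z≤n
... | inj₂ (one , hit)  rewrite one  = sumDiffHits-pos z u v (HitsPair⇒sumDiffHit p+q≡z hit)

DisjointPairs : V → V → V → V → Set
DisjointPairs p q p' q' = ∀ v → v ≡± p ⊎ v ≡± q → v ≡± p' ⊎ v ≡± q' → ⊥

hitsPairs≤sumDiffHits : ∀ {p q p' q' z} → p ⊕ q ≡ z → p' ⊕ q' ≡ z →
  Disjoint± p q → Disjoint± p' q' → DisjointPairs p q p' q' →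
  ∀ u v → hitsPair p q u v ℕ.+ hitsPair p' q' u v ℕ.≤ sumDiffHits z u v
hitsPairs≤sumDiffHits {z = z} p+q≡z p'+q'≡z disj disj' disjPairs u v
  with hitsPair-cases disj u v | hitsPair-cases disj' u v
... | inj₁ none | inj₁ none' rewrite none | none' = z≤n
... | inj₁ none | inj₂ (one' , hit') rewrite none | one' = sumDiffHits-pos z u v (HitsPair⇒sumDiffHit p'+q'≡z hit')
... | inj₂ (one , hit) | inj₁ none' rewrite one | none' = sumDiffHits-pos z u v (HitsPair⇒sumDiffHit p+q≡z hit)
... | inj₂ (_ , hit) | inj₂ (_ , hit') = ⊥-elim (disjPairs u (first hit) (first hit'))
  where
  first : ∀ {c d} → HitsPair c d u v → u ≡± c ⊎ u ≡± d
  first (inj₁ (u≡±c , _)) = inj₁ u≡±c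
  first (inj₂ (u≡±d , _)) = inj₂ u≡±d

pairSum-hitsPair-halfRect : ∀ {a b S c d} → IsHalfRect a b S → RectPoint a b c → RectPoint a b d →
  Disjoint± c d → pairSum (hitsPair c d) S ≡ 1
pairSum-hitsPair-halfRect {S = S} {c} {d} halfRect (c∈ , c≢0) (d∈ , d≢0) disj =
  trans (pairSum-hitsPair disj S)
        (cong₂ ℕ._*_ (count±-halfRect halfRect c c∈ c≢0) (count±-halfRect halfRect d d∈ d≢0))

decomposition⇒count±-D-pos : ∀ {a b S p q z} → IsHalfRect a b S → RectPoint a b p → RectPoint a b q →
  p ⊕ q ≡ z → Disjoint± p q → 1 ℕ.≤ count± z (D S)
decomposition⇒count±-D-pos {S = S} {p} {q} {z} halfRect p∈ q∈ p+q≡z disj = begin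
  1                          ≡⟨ sym (pairSum-hitsPair-halfRect halfRect p∈ q∈ disj) ⟩
  pairSum (hitsPair p q) S   ≤⟨ pairSum-mono S (hitsPair≤sumDiffHits p+q≡z disj) ⟩
  pairSum (sumDiffHits z) S  ≤⟨ sumDiffHits≤count±-D z S ⟩
  count± z (D S)             ∎
  where open ℕP.≤-Reasoning

two-decompositions⇒count±-D≥2 : ∀ {a b S p q p' q' z} → IsHalfRect a b S →
  RectPoint a b p → RectPoint a b q → RectPoint a b p' → RectPoint a b q' →
  p ⊕ q ≡ z → p' ⊕ q' ≡ z → Disjoint± p q → Disjoint± p' q' → DisjointPairs p q p' q' →
  2 ℕ.≤ count± z (D S)
two-decompositions⇒count±-D≥2 {S = S} {p} {q} {p'} {q'} {z}
  halfRect p∈ q∈ p'∈ q'∈ p+q≡z p'+q'≡z disj disj' disjPairs = begin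
  2
    ≡⟨ sym (cong₂ ℕ._+_ (pairSum-hitsPair-halfRect halfRect p∈ q∈ disj)
                        (pairSum-hitsPair-halfRect halfRect p'∈ q'∈ disj')) ⟩
  pairSum (hitsPair p q) S ℕ.+ pairSum (hitsPair p' q') S
    ≡⟨ sym (pairSum-+ (hitsPair p q) (hitsPair p' q') S) ⟩
  pairSum (λ u v → hitsPair p q u v ℕ.+ hitsPair p' q' u v) S
    ≤⟨ pairSum-mono S (hitsPairs≤sumDiffHits p+q≡z p'+q'≡z disj disj' disjPairs) ⟩
  pairSum (sumDiffHits z) S
    ≤⟨ sumDiffHits≤count±-D z S ⟩
  count± z (D S) ∎
  where open ℕP.≤-Reasoning

InBox : ℕ → ℕ → V → Set
InBox a b (x , y) = ∣ x ∣ ℕ.≤ a × ∣ y ∣ ℕ.≤ b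

bounded⇒∣∣≤ : ∀ a x → - (+ a) ≤ x → x ≤ + a → ∣ x ∣ ℕ.≤ a
bounded⇒∣∣≤ a       (+ n)    _          (+≤+ n≤a) = n≤a
bounded⇒∣∣≤ (suc a) -[1+ n ] (-≤- n≤a) _          = s≤s n≤a

∣∣≤⇒bounded : ∀ a x → ∣ x ∣ ℕ.≤ a → - (+ a) ≤ x × x ≤ + a
∣∣≤⇒bounded a       (+ n)    n≤a       = ℤP.neg-≤-pos , +≤+ n≤a
∣∣≤⇒bounded (suc a) -[1+ n ] (s≤s n≤a) = -≤- n≤a , -≤+

inRect⇒inBox : ∀ {a b} v → InRect a b v → InBox a b v
inRect⇒inBox {a} {b} (x , y) ((x≥ , x≤) , (y≥ , y≤)) = bounded⇒∣∣≤ a x x≥ x≤ , bounded⇒∣∣≤ b y y≥ y≤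

inBox⇒inRect : ∀ {a b} v → InBox a b v → InRect a b v
inBox⇒inRect {a} {b} (x , y) (∣x∣≤ , ∣y∣≤) = ∣∣≤⇒bounded a x ∣x∣≤ , ∣∣≤⇒bounded b y ∣y∣≤

inBox⇒rectPoint : ∀ {a b} v → InBox a b v → v ≢ zeroV → RectPoint a b v
inBox⇒rectPoint v v∈ v≢0 = inBox⇒inRect v v∈ , v≢0

∣∣≡0⇒zero : ∀ v → ∣ proj₁ v ∣ ≡ 0 → ∣ proj₂ v ∣ ≡ 0 → v ≡ zeroV
∣∣≡0⇒zero (x , y) ∣x∣≡0 ∣y∣≡0 = cong₂ _,_ (ℤP.∣i∣≡0⇒i≡0 ∣x∣≡0) (ℤP.∣i∣≡0⇒i≡0 ∣y∣≡0)

∣2*∣ : ∀ x → ∣ + 2 * x ∣ ≡ ∣ x ∣ ℕ.+ ∣ x ∣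
∣2*∣ x = trans (ℤP.abs-* (+ 2) x) (cong (∣ x ∣ ℕ.+_) (ℕP.+-identityʳ ∣ x ∣))

double-nonzero : ∀ u → u ≢ zeroV → (+ 2) · u ≢ zeroV
double-nonzero (x , y) u≢0 eq = u≢0 (∣∣≡0⇒zero (x , y) (half x (cong proj₁ eq)) (half y (cong proj₂ eq)))
  where
  half : ∀ x → + 2 * x ≡ + 0 → ∣ x ∣ ≡ 0
  half x 2x≡0 = ℕP.m+n≡0⇒m≡0 ∣ x ∣ (trans (sym (∣2*∣ x)) (cong ∣_∣ 2x≡0))

D-nonzero-inBox : ∀ a b S → Unique S → All (λ u → InBox a b u × u ≢ zeroV) S →
  (∀ u v → u ∈ S → v ∈ S → v ≢ neg u) → All (λ z → z ≢ zeroV × InBox (a ℕ.+ a) (b ℕ.+ b) z) (D S)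
D-nonzero-inBox a b []      _              _                   _ = []
D-nonzero-inBox a b (u ∷ S) (u∉ ∷ unique) ((u∈ , u≢0) ∷ inBox) noAntipodes =
  (double-nonzero u u≢0 , double-inBox u u∈) ∷
  ++⁺ (row S (λ v∈ → All.lookup u∉ v∈) inBox (λ v v∈ → noAntipodes u v (here refl) (there v∈)))
      (D-nonzero-inBox a b S unique inBox (λ u' v' u'∈ v'∈ → noAntipodes u' v' (there u'∈) (there v'∈)))
  where
  double-inBox : ∀ u → InBox a b u → InBox (a ℕ.+ a) (b ℕ.+ b) ((+ 2) · u)
  double-inBox (x , y) (∣x∣≤ , ∣y∣≤) =
    subst (ℕ._≤ a ℕ.+ a) (sym (∣2*∣ x)) (ℕP.+-mono-≤ ∣x∣≤ ∣x∣≤) ,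
    subst (ℕ._≤ b ℕ.+ b) (sym (∣2*∣ y)) (ℕP.+-mono-≤ ∣y∣≤ ∣y∣≤)
  sum-inBox : ∀ u v → InBox a b u → InBox a b v → InBox (a ℕ.+ a) (b ℕ.+ b) (u ⊕ v)
  sum-inBox (x , y) (x' , y') (∣x∣≤ , ∣y∣≤) (∣x'∣≤ , ∣y'∣≤) =
    ℕP.≤-trans (ℤP.∣i+j∣≤∣i∣+∣j∣ x x') (ℕP.+-mono-≤ ∣x∣≤ ∣x'∣≤) ,
    ℕP.≤-trans (ℤP.∣i+j∣≤∣i∣+∣j∣ y y') (ℕP.+-mono-≤ ∣y∣≤ ∣y'∣≤)
  diff-inBox : ∀ u v → InBox a b u → InBox a b v → InBox (a ℕ.+ a) (b ℕ.+ b) (u ⊖ v)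
  diff-inBox (x , y) (x' , y') (∣x∣≤ , ∣y∣≤) (∣x'∣≤ , ∣y'∣≤) =
    ℕP.≤-trans (ℤP.∣i-j∣≤∣i∣+∣j∣ x x') (ℕP.+-mono-≤ ∣x∣≤ ∣x'∣≤) ,
    ℕP.≤-trans (ℤP.∣i-j∣≤∣i∣+∣j∣ y y') (ℕP.+-mono-≤ ∣y∣≤ ∣y'∣≤)
  row : ∀ T → (∀ {v} → v ∈ T → u ≢ v) → All (λ u → InBox a b u × u ≢ zeroV) T → (∀ v → v ∈ T → v ≢ neg u) →
        All (λ z → z ≢ zeroV × InBox (a ℕ.+ a) (b ℕ.+ b) z) (concatMap (λ v → (u ⊕ v) ∷ (u ⊖ v) ∷ []) T)
  row []      _      _                   _ = []
  row (v ∷ T) u≢T ((v∈ , _) ∷ inBoxT) T≢-u =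
    ((λ eq → T≢-u v (here refl) (⊕≡zero⇒≡neg u v eq)) , sum-inBox u v u∈ v∈) ∷
    ((λ eq → u≢T (here refl) (⊖≡zero⇒≡ u v eq)) , diff-inBox u v u∈ v∈) ∷
    row T (λ v∈T → u≢T (there v∈T)) inBoxT (λ v' v'∈ → T≢-u v' (there v'∈))

halfRect-D-nonzero-inBox : ∀ {a b S} → IsHalfRect a b S → All (λ z → z ≢ zeroV × InBox (a ℕ.+ a) (b ℕ.+ b) z) (D S)
halfRect-D-nonzero-inBox {a} {b} {S} (unique , inRect , _ , antipodal) =
  D-nonzero-inBox a b S unique
    (All.tabulate λ {u} u∈ → inRect⇒inBox u (proj₁ (inRect u u∈)) , proj₂ (inRect u u∈))
    (λ u v u∈ v∈ v≡-u → antipodal u u∈ (subst (_∈ S) v≡-u v∈))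

-- Symmetries of the rectangle

record RectSymmetry (a b a' b' : ℕ) : Set where
  field
    act            : V → V
    act-involutive : ∀ v → act (act v) ≡ v
    act-⊕          : ∀ u v → act (u ⊕ v) ≡ act u ⊕ act v
    act-⊖          : ∀ u v → act (u ⊖ v) ≡ act u ⊖ act v
    act-·          : ∀ c v → act (c · v) ≡ c · act v
    act-neg        : ∀ v → act (neg v) ≡ neg (act v)
    act-zero       : act zeroV ≡ zeroV
    act-inBox      : ∀ v → InBox a b v → InBox a' b' (act v)
    act-inBox⁻     : ∀ v → InBox a' b' v → InBox a b (act v)

module _ {a b a' b'} (σ : RectSymmetry a b a' b') where
  open RectSymmetry σ

  act-injective : ∀ {u v} → act u ≡ act v → u ≡ v
  act-injective {u} {v} eq = trans (sym (act-involutive u)) (trans (cong act eq) (act-involutive v))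

  D-map : ∀ S → D (map act S) ≡ map act (D S)
  D-map []      = refl
  D-map (u ∷ S) = cong₂ _∷_ (sym (act-· (+ 2) u))
    (trans (cong₂ _++_ (row S) (D-map S)) (sym (map-++ act (concatMap (λ v → (u ⊕ v) ∷ (u ⊖ v) ∷ []) S) (D S))))
    where
    row : ∀ T → concatMap (λ v → (act u ⊕ v) ∷ (act u ⊖ v) ∷ []) (map act T)
              ≡ map act (concatMap (λ v → (u ⊕ v) ∷ (u ⊖ v) ∷ []) T)
    row []      = refl
    row (v ∷ T) = cong₂ _∷_ (sym (act-⊕ u v)) (cong₂ _∷_ (sym (act-⊖ u v)) (row T))

  halfRect-map : ∀ S → IsHalfRect a b S → IsHalfRect a' b' (map act S)
  halfRect-map S (unique , inRect , covers , antipodal) = map⁺ act-injective unique , inRect′ , covers′ , antipodal′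
    where
    inRect′ : ∀ v → v ∈ map act S → InRect a' b' v × v ≢ zeroV
    inRect′ v v∈ with ∈-map⁻ act v∈
    ... | (u , u∈ , refl) =
      inBox⇒inRect (act u) (act-inBox u (inRect⇒inBox u (proj₁ (inRect u u∈)))) ,
      λ eq → proj₂ (inRect u u∈) (act-injective (trans eq (sym act-zero)))
    covers′ : ∀ v → InRect a' b' v → v ≢ zeroV → v ∈ map act S ⊎ neg v ∈ map act S
    covers′ v v∈ v≢0
      with covers (act v) (inBox⇒inRect (act v) (act-inBox⁻ v (inRect⇒inBox v v∈)))
                  (λ eq → v≢0 (trans (sym (act-involutive v)) (trans (cong act eq) act-zero)))
    ... | inj₁ u∈ = inj₁ (subst (_∈ map act S) (act-involutive v) (∈-map⁺ act u∈))
    ... | inj₂ u∈ =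
      inj₂ (subst (_∈ map act S) (trans (act-neg (act v)) (cong neg (act-involutive v))) (∈-map⁺ act u∈))
    antipodal′ : ∀ v → v ∈ map act S → ¬ (neg v ∈ map act S)
    antipodal′ v v∈ -v∈ with ∈-map⁻ act v∈ | ∈-map⁻ act -v∈
    ... | (u , u∈ , refl) | (u' , u'∈ , eq) =
      antipodal u u∈ (subst (_∈ S) (sym (act-injective (trans (act-neg u) eq))) u'∈)

  act-≡± : ∀ {v z} → v ≡± z → act v ≡± act z
  act-≡±     (inj₁ refl) = inj₁ refl
  act-≡± {z = z} (inj₂ refl) = inj₂ (act-neg z)

  act-≡±⁻ : ∀ {v z} → act v ≡± act z → v ≡± z
  act-≡±⁻         (inj₁ eq) = inj₁ (act-injective eq)
  act-≡±⁻ {z = z} (inj₂ eq) = inj₂ (act-injective (trans eq (sym (act-neg z))))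

  count±-map : ∀ z L → count± (act z) (map act L) ≡ count± z L
  count±-map z []      = refl
  count±-map z (v ∷ L) = cong₂ ℕ._+_ (indicator-cong act-≡±⁻ act-≡± (act v ≟± act z) (v ≟± z)) (count±-map z L)

  count±-D-map : ∀ z S → count± (act z) (D (map act S)) ≡ count± z (D S)
  count±-D-map z S = trans (cong (count± (act z)) (D-map S)) (count±-map z (D S))

  proportional-act : ∀ u v → Proportional u v → Proportional (act u) (act v)
  proportional-act u v (l , m , nontrivial , eq) =
    l , m , nontrivial , trans (sym (act-· l u)) (trans (cong act eq) (act-· m v))

  primitive-act : ∀ z → Primitive z → Primitive (act z)
  primitive-act z prim p k n 0<k k<n n·p≡k·z =
    prim (act p) k n 0<k k<n (begin
      (+ n) · act p        ≡⟨ sym (act-· (+ n) p) ⟩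
      act ((+ n) · p)      ≡⟨ cong act n·p≡k·z ⟩
      act ((+ k) · act z)  ≡⟨ act-· (+ k) (act z) ⟩
      (+ k) · act (act z)  ≡⟨ cong ((+ k) ·_) (act-involutive z) ⟩
      (+ k) · z            ∎)
    where open ≡-Reasoning

swapᵥ : V → V
swapᵥ (x , y) = (y , x)

swap-symmetry : ∀ a b → RectSymmetry a b b a
swap-symmetry a b = record
  { act = swapᵥ ; act-involutive = λ _ → refl
  ; act-⊕ = λ _ _ → refl ; act-⊖ = λ _ _ → refl ; act-· = λ _ _ → refl ; act-neg = λ _ → refl ; act-zero = refl
  ; act-inBox = λ { (x , y) (∣x∣≤ , ∣y∣≤) → ∣y∣≤ , ∣x∣≤ } ; act-inBox⁻ = λ { (x , y) (∣x∣≤ , ∣y∣≤) → ∣y∣≤ , ∣x∣≤ } }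

neg-inBox : ∀ {a b} v → InBox a b v → InBox a b (neg v)
neg-inBox {a} {b} (x , y) (∣x∣≤ , ∣y∣≤) =
  subst (ℕ._≤ a) (sym (ℤP.∣-i∣≡∣i∣ x)) ∣x∣≤ , subst (ℕ._≤ b) (sym (ℤP.∣-i∣≡∣i∣ y)) ∣y∣≤

neg-symmetry : ∀ a b → RectSymmetry a b a b
neg-symmetry a b = record
  { act = neg ; act-involutive = neg-involutive
  ; act-⊕ = neg-distrib-⊕ ; act-⊖ = neg-distrib-⊖ ; act-· = neg-· ; act-neg = λ _ → refl ; act-zero = refl
  ; act-inBox = neg-inBox ; act-inBox⁻ = neg-inBox }

flipˣ : V → V
flipˣ (x , y) = (- x , y)

flipˣ-symmetry : ∀ a b → RectSymmetry a b a b
flipˣ-symmetry a b = record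
  { act = flipˣ
  ; act-involutive = λ { (x , y) → cong (_, y) (ℤP.neg-involutive x) }
  ; act-⊕ = λ { (x , y) (x' , y') → cong (_, y + y') (ℤP.neg-distrib-+ x x') }
  ; act-⊖ = λ { (x , y) (x' , y') → cong (_, y - y') (ℤP.neg-distrib-+ x (- x')) }
  ; act-· = λ { c (x , y) → cong (_, c * y) (ℤP.neg-distribʳ-* c x) }
  ; act-neg = λ _ → refl ; act-zero = refl
  ; act-inBox = flip ; act-inBox⁻ = flip }
  where
  flip : ∀ v → InBox a b v → InBox a b (flipˣ v)
  flip (x , y) (∣x∣≤ , ∣y∣≤) = subst (ℕ._≤ a) (sym (ℤP.∣-i∣≡∣i∣ x)) ∣x∣≤ , ∣y∣≤

flipʸ : V → V
flipʸ (x , y) = (x , - y)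

flipʸ-symmetry : ∀ a b → RectSymmetry a b a b
flipʸ-symmetry a b = record
  { act = flipʸ
  ; act-involutive = λ { (x , y) → cong (x ,_) (ℤP.neg-involutive y) }
  ; act-⊕ = λ { (x , y) (x' , y') → cong (x + x' ,_) (ℤP.neg-distrib-+ y y') }
  ; act-⊖ = λ { (x , y) (x' , y') → cong (x - x' ,_) (ℤP.neg-distrib-+ y (- y')) }
  ; act-· = λ { c (x , y) → cong (c * x ,_) (ℤP.neg-distribʳ-* c y) }
  ; act-neg = λ _ → refl ; act-zero = refl
  ; act-inBox = flip ; act-inBox⁻ = flip }
  where
  flip : ∀ v → InBox a b v → InBox a b (flipʸ v)
  flip (x , y) (∣x∣≤ , ∣y∣≤) = ∣x∣≤ , subst (ℕ._≤ b) (sym (ℤP.∣-i∣≡∣i∣ y)) ∣y∣≤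

id-symmetry : ∀ a b → RectSymmetry a b a b
id-symmetry a b = record
  { act = λ v → v ; act-involutive = λ _ → refl
  ; act-⊕ = λ _ _ → refl ; act-⊖ = λ _ _ → refl ; act-· = λ _ _ → refl ; act-neg = λ _ → refl ; act-zero = refl
  ; act-inBox = λ _ v∈ → v∈ ; act-inBox⁻ = λ _ v∈ → v∈ }

absᵥ : V → V
absᵥ (x , y) = (+ ∣ x ∣ , + ∣ y ∣)

sign-normalizer : ∀ a b v → Σ (RectSymmetry a b a b) λ σ → RectSymmetry.act σ v ≡ absᵥ v
sign-normalizer a b (+ m      , + n)      = id-symmetry a b , refl
sign-normalizer a b (+ m      , -[1+ n ]) = flipʸ-symmetry a b , refl
sign-normalizer a b (-[1+ m ] , + n)      = flipˣ-symmetry a b , refl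
sign-normalizer a b (-[1+ m ] , -[1+ n ]) = neg-symmetry a b , refl

primitive-absᵥ : ∀ v → Primitive v → Primitive (absᵥ v)
primitive-absᵥ v prim = let (σ , σv≡∣v∣) = sign-normalizer 0 0 v in subst Primitive σv≡∣v∣ (primitive-act σ v prim)

count±-D≥2-transport : ∀ {a b a' b'} (σ : RectSymmetry a b a' b') {z w S} → RectSymmetry.act σ z ≡ w →
  2 ℕ.≤ count± w (D (map (RectSymmetry.act σ) S)) → 2 ℕ.≤ count± z (D S)
count±-D≥2-transport σ {z} {S = S} refl two≤ = subst (2 ℕ.≤_) (count±-D-map σ z S) two≤

-- The class ±(2a - 1, 2b) in D(S)

w₁ w₂ : ℕ → ℕ → V
w₁ a b = (+ 2 * + a - + 1 , + 2 * + b)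
w₂ a b = (+ 2 * + a , + 2 * + b - + 1)

+-cancelʳ-≤ : ∀ x y c → x + c ≤ y + c → x ≤ y
+-cancelʳ-≤ x y c x+c≤y+c = subst₂ _≤_ (cancel x c) (cancel y c) (ℤP.+-monoˡ-≤ (- c) x+c≤y+c)
  where
  cancel : ∀ x c → (x + c) + - c ≡ x
  cancel = solve-∀

sum≡2c⇒both≡c : ∀ x y c → x ≤ c → y ≤ c → x + y ≡ + 2 * c → x ≡ c × y ≡ c
sum≡2c⇒both≡c x y c x≤c y≤c x+y≡2c = ≡c x y x≤c y≤c x+y≡2c , ≡c y x y≤c x≤c (trans (ℤP.+-comm y x) x+y≡2c)
  where
  ≡c : ∀ x y → x ≤ c → y ≤ c → x + y ≡ + 2 * c → x ≡ c
  ≡c x y x≤c y≤c x+y≡2c =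
    ℤP.≤-antisym x≤c (+-cancelʳ-≤ c x c (subst (_≤ x + c) (trans x+y≡2c (double c)) (ℤP.+-monoʳ-≤ x y≤c)))
    where
    double : ∀ c → + 2 * c ≡ c + c
    double = solve-∀

sum≡2c-1⇒≡c,c-1 : ∀ x y c → x ≤ c → y ≤ c → x + y ≡ + 2 * c - + 1 →
  (x ≡ c × y ≡ c - + 1) ⊎ (x ≡ c - + 1 × y ≡ c)
sum≡2c-1⇒≡c,c-1 x y c x≤c y≤c x+y≡2c-1 with x ℤ.≟ c
... | yes refl = inj₁ (refl , trans (other x y) (trans (cong (_- x) x+y≡2c-1) (eval x)))
  where
  other : ∀ x y → y ≡ (x + y) - x
  other = solve-∀
  eval : ∀ x → (+ 2 * x - + 1) - x ≡ x - + 1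
  eval = solve-∀
... | no x≢c = inj₂ (x≡c-1 , (begin
  y                          ≡⟨ other x y ⟩
  (x + y) - x                ≡⟨ cong (_- x) x+y≡2c-1 ⟩
  (+ 2 * c - + 1) - x        ≡⟨ cong (λ t → (+ 2 * c - + 1) - t) x≡c-1 ⟩
  (+ 2 * c - + 1) - (c - + 1) ≡⟨ eval c ⟩
  c                          ∎))
  where
  open ≡-Reasoning
  other : ∀ x y → y ≡ (x + y) - x
  other = solve-∀
  eval : ∀ c → (+ 2 * c - + 1) - (c - + 1) ≡ c
  eval = solve-∀
  split : ∀ c → + 2 * c - + 1 ≡ (c - + 1) + c
  split = solve-∀
  c-1≤x : c - + 1 ≤ x
  c-1≤x = +-cancelʳ-≤ (c - + 1) x c (subst (_≤ x + c) (trans x+y≡2c-1 (split c)) (ℤP.+-monoʳ-≤ x y≤c))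
  x≡c-1 : x ≡ c - + 1
  x≡c-1 = ℤP.≤-antisym (subst (x ≤_) (ℤP.+-comm -[1+ 0 ] c) (ℤP.i<j⇒i≤pred[j] (ℤP.≤∧≢⇒< x≤c x≢c))) c-1≤x

neg-inRect : ∀ {a b} u → InRect a b u → InRect a b (neg u)
neg-inRect u u∈ = inBox⇒inRect (neg u) (neg-inBox u (inRect⇒inBox u u∈))

neg-≡±⁻ : ∀ {v c} → neg v ≡± c → v ≡± c
neg-≡±⁻ (inj₁ eq) = inj₂ (neg-swap eq)
neg-≡±⁻ (inj₂ eq) = inj₁ (neg-injective eq)

sum≡neg⇒neg-sum≡ : ∀ u v w → u ⊕ v ≡ neg w → neg u ⊕ neg v ≡ w
sum≡neg⇒neg-sum≡ u v w eq = trans (sym (neg-distrib-⊕ u v)) (trans (cong neg eq) (neg-involutive w))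

cornerA cornerB : ℕ → ℕ → V
cornerA a b = (+ a , + b)
cornerB a b = (+ a - + 1 , + b)

decompose-w₁ : ∀ {a b} u v → InRect a b u → InRect a b v → u ⊕ v ≡ w₁ a b →
  (u ≡ cornerA a b × v ≡ cornerB a b) ⊎ (u ≡ cornerB a b × v ≡ cornerA a b)
decompose-w₁ {a} {b} (x , y) (x' , y') ((_ , x≤) , (_ , y≤)) ((_ , x'≤) , (_ , y'≤)) eq
  with sum≡2c⇒both≡c y y' (+ b) y≤ y'≤ (cong proj₂ eq)
... | refl , refl with sum≡2c-1⇒≡c,c-1 x x' (+ a) x≤ x'≤ (cong proj₁ eq)
...   | inj₁ (refl , refl) = inj₁ (refl , refl)
...   | inj₂ (refl , refl) = inj₂ (refl , refl)

sum≡±w₁⇒corners : ∀ {a b} u v → InRect a b u → InRect a b v → u ⊕ v ≡± w₁ a b →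
  HitsPair (cornerA a b) (cornerB a b) u v
sum≡±w₁⇒corners u v u∈ v∈ (inj₁ eq) with decompose-w₁ u v u∈ v∈ eq
... | inj₁ (refl , refl) = inj₁ (inj₁ refl , inj₁ refl)
... | inj₂ (refl , refl) = inj₂ (inj₁ refl , inj₁ refl)
sum≡±w₁⇒corners u v u∈ v∈ (inj₂ eq)
  with decompose-w₁ (neg u) (neg v) (neg-inRect u u∈) (neg-inRect v v∈) (sum≡neg⇒neg-sum≡ u v _ eq)
... | inj₁ (-u≡ , -v≡) = inj₁ (neg-≡±⁻ (inj₁ -u≡) , neg-≡±⁻ (inj₁ -v≡))
... | inj₂ (-u≡ , -v≡) = inj₂ (neg-≡±⁻ (inj₁ -u≡) , neg-≡±⁻ (inj₁ -v≡))

-- u ⊖ v is definitionally u ⊕ neg v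
diff≡±w₁⇒corners : ∀ {a b} u v → InRect a b u → InRect a b v → u ⊖ v ≡± w₁ a b →
  HitsPair (cornerA a b) (cornerB a b) u v
diff≡±w₁⇒corners u v u∈ v∈ hit with sum≡±w₁⇒corners u (neg v) u∈ (neg-inRect v v∈) hit
... | inj₁ (u≡± , -v≡±) = inj₁ (u≡± , neg-≡±⁻ -v≡±)
... | inj₂ (u≡± , -v≡±) = inj₂ (u≡± , neg-≡±⁻ -v≡±)

sum≡±w₁⇒y≡±b : ∀ {a b} u v → InRect a b u → InRect a b v → u ⊕ v ≡± w₁ a b →
  (proj₂ u ≡ + b × proj₂ v ≡ + b) ⊎ (proj₂ (neg u) ≡ + b × proj₂ (neg v) ≡ + b)
sum≡±w₁⇒y≡±b {b = b} u v u∈ v∈ (inj₁ eq) =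
  inj₁ (sum≡2c⇒both≡c (proj₂ u) (proj₂ v) (+ b) (proj₂ (proj₂ u∈)) (proj₂ (proj₂ v∈)) (cong proj₂ eq))
sum≡±w₁⇒y≡±b {b = b} u v u∈ v∈ (inj₂ eq) =
  inj₂ (sum≡2c⇒both≡c (proj₂ (neg u)) (proj₂ (neg v)) (+ b)
         (proj₂ (proj₂ (neg-inRect u u∈))) (proj₂ (proj₂ (neg-inRect v v∈))) (cong proj₂ (sum≡neg⇒neg-sum≡ u v _ eq)))

±b⇒b≡0 : ∀ b t → t ≡ + b → - t ≡ + b → b ≡ 0
±b⇒b≡0 b t refl -b≡b = ℤP.+-injective (≡-neg⇒zero (+ b) (sym -b≡b))

sum-and-diff-≢±w₁ : ∀ {a b} → 0 < b → ∀ u v → InRect a b u → InRect a b v →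
  u ⊕ v ≡± w₁ a b → u ⊖ v ≡± w₁ a b → ⊥
sum-and-diff-≢±w₁ {b = b} 0<b u v u∈ v∈ sumHit diffHit = ℕP.<⇒≢ 0<b (sym b≡0)
  where
  b≡0 : b ≡ 0
  b≡0 with sum≡±w₁⇒y≡±b u v u∈ v∈ sumHit | sum≡±w₁⇒y≡±b u (neg v) u∈ (neg-inRect v v∈) diffHit
  ... | inj₁ (_ , v≡b)    | inj₁ (_ , -v≡b)    = ±b⇒b≡0 b _ v≡b -v≡b
  ... | inj₁ (u≡b , _)    | inj₂ (-u≡b , _)    = ±b⇒b≡0 b _ u≡b -u≡b
  ... | inj₂ (-u≡b , _)   | inj₁ (u≡b , _)     = ±b⇒b≡0 b _ u≡b -u≡b
  ... | inj₂ (_ , -v≡b)   | inj₂ (_ , neg²v≡b)   = ±b⇒b≡0 b _ -v≡b neg²v≡b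

sumDiffHits-w₁≤hitsPair : ∀ {a b} → 0 < b → ∀ u v → InRect a b u → InRect a b v →
  sumDiffHits (w₁ a b) u v ℕ.≤ hitsPair (cornerA a b) (cornerB a b) u v
sumDiffHits-w₁≤hitsPair {a} {b} 0<b u v u∈ v∈ =
  indicator-+-≤ (u ⊕ v ≟± w₁ a b) (u ⊖ v ≟± w₁ a b) _ (sum-and-diff-≢±w₁ 0<b u v u∈ v∈) λ
    { (inj₁ sumHit)  → HitsPair⇒hitsPair-pos _ _ u v (sum≡±w₁⇒corners u v u∈ v∈ sumHit)
    ; (inj₂ diffHit) → HitsPair⇒hitsPair-pos _ _ u v (diff≡±w₁⇒corners u v u∈ v∈ diffHit) }

2*≢1 : ∀ t → + 2 * t ≢ + 1
2*≢1 t eq = ℕP.even≢odd ∣ t ∣ 0 (trans (sym (ℤP.abs-* (+ 2) t)) (cong ∣_∣ eq))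

double≢±w₁ : ∀ a b u → ¬ (+ 2) · u ≡± w₁ a b
double≢±w₁ a b (x , y) (inj₁ eq) = 2*≢1 (+ a - x) (begin
  + 2 * (+ a - x)                        ≡⟨ expand (+ a) x ⟩
  ((+ 2 * + a - + 1) - + 2 * x) + + 1    ≡⟨ cong (λ t → (t - + 2 * x) + + 1) (sym (cong proj₁ eq)) ⟩
  (+ 2 * x - + 2 * x) + + 1              ≡⟨ cancel x ⟩
  + 1                                    ∎)
  where
  open ≡-Reasoning
  expand : ∀ a x → + 2 * (a - x) ≡ ((+ 2 * a - + 1) - + 2 * x) + + 1
  expand = solve-∀
  cancel : ∀ x → (+ 2 * x - + 2 * x) + + 1 ≡ + 1
  cancel = solve-∀
double≢±w₁ a b (x , y) (inj₂ eq) = 2*≢1 (x + + a) (begin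
  + 2 * (x + + a)                                   ≡⟨ expand (+ a) x ⟩
  (+ 2 * x + (+ 2 * + a - + 1)) + + 1               ≡⟨ cong (λ t → (t + (+ 2 * + a - + 1)) + + 1) (cong proj₁ eq) ⟩
  (- (+ 2 * + a - + 1) + (+ 2 * + a - + 1)) + + 1   ≡⟨ cancel (+ a) ⟩
  + 1                                               ∎)
  where
  open ≡-Reasoning
  expand : ∀ a x → + 2 * (x + a) ≡ (+ 2 * x + (+ 2 * a - + 1)) + + 1
  expand = solve-∀
  cancel : ∀ a → (- (+ 2 * a - + 1) + (+ 2 * a - + 1)) + + 1 ≡ + 1
  cancel = solve-∀

a-1<a : ∀ a → + a - + 1 ℤ.< + a
a-1<a a = subst (ℤ._< + a) (ℤP.+-comm -[1+ 0 ] (+ a)) (ℤP.i≤pred[j]⇒i<j ℤP.≤-refl)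

corners-disjoint : ∀ a b → 0 < b → Disjoint± (cornerA a b) (cornerB a b)
corners-disjoint a b 0<b = disjoint± _ _
  (λ eq → ℤP.<-irrefl (sym (cong proj₁ eq)) (a-1<a a))
  (λ eq → ℕP.<⇒≢ 0<b (sym (±b⇒b≡0 b (+ b) refl (sym (cong proj₂ eq)))))

corners-rectPoint : ∀ {a b} → 0 < a → 0 < b → RectPoint a b (cornerA a b) × RectPoint a b (cornerB a b)
corners-rectPoint {suc a₀} {b} _ 0<b =
  (inBox⇒inRect (cornerA (suc a₀) b) (ℕP.≤-refl , ℕP.≤-refl) , y≢0) ,
  (inBox⇒inRect (cornerB (suc a₀) b) (ℕP.n≤1+n a₀ , ℕP.≤-refl) , y≢0)
  where
  y≢0 : ∀ {x} → (x , + b) ≢ zeroV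
  y≢0 eq = ℕP.<⇒≢ 0<b (sym (ℤP.+-injective (cong proj₂ eq)))

corners-sum : ∀ a b → cornerA a b ⊕ cornerB a b ≡ w₁ a b
corners-sum a b = cong₂ _,_ (sum (+ a)) (double (+ b))
  where
  sum : ∀ a → a + (a - + 1) ≡ + 2 * a - + 1
  sum = solve-∀
  double : ∀ b → b + b ≡ + 2 * b
  double = solve-∀

count±-w₁-D : ∀ {a b S} → 0 < a → 0 < b → IsHalfRect a b S → count± (w₁ a b) (D S) ≡ 1
count±-w₁-D {a} {b} {S} 0<a 0<b halfRect@(_ , inRect , _) = ℕP.≤-antisym upper lower
  where
  A∈ = proj₁ (corners-rectPoint 0<a 0<b)
  B∈ = proj₂ (corners-rectPoint 0<a 0<b)
  open ℕP.≤-Reasoning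
  upper : count± (w₁ a b) (D S) ℕ.≤ 1
  upper = begin
    count± (w₁ a b) (D S)
      ≡⟨ count±-D (w₁ a b) S ⟩
    sumBy (doubleHit (w₁ a b)) S ℕ.+ pairSum (sumDiffHits (w₁ a b)) S
      ≡⟨ cong (ℕ._+ pairSum (sumDiffHits (w₁ a b)) S) (sumBy-zero S λ u → indicator-no _ (double≢±w₁ a b u)) ⟩
    pairSum (sumDiffHits (w₁ a b)) S
      ≤⟨ pairSum-mono-All (InRect a b) S (All.tabulate λ {u} u∈ → proj₁ (inRect u u∈)) (sumDiffHits-w₁≤hitsPair 0<b) ⟩
    pairSum (hitsPair (cornerA a b) (cornerB a b)) S
      ≡⟨ pairSum-hitsPair-halfRect halfRect A∈ B∈ (corners-disjoint a b 0<b) ⟩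
    1 ∎
  lower : 1 ℕ.≤ count± (w₁ a b) (D S)
  lower = decomposition⇒count±-D-pos halfRect A∈ B∈ (corners-sum a b) (corners-disjoint a b 0<b)

-- Vectors proportional to a primitive vector

*-≡0⇒≡0 : ∀ m x → m ≢ + 0 → m * x ≡ + 0 → x ≡ + 0
*-≡0⇒≡0 m x m≢0 mx≡0 = Sum.[ ⊥-elim ∘ m≢0 , id ]′ (ℤP.i*j≡0⇒i≡0∨j≡0 m mx≡0)

·-zero-cancel : ∀ n → 0 < n → ∀ z → (+ n) · z ≡ zeroV → z ≡ zeroV
·-zero-cancel n 0<n (x , y) eq =
  cong₂ _,_ (*-≡0⇒≡0 (+ n) x n≢0 (cong proj₁ eq)) (*-≡0⇒≡0 (+ n) y n≢0 (cong proj₂ eq))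
  where
  n≢0 : + n ≢ + 0
  n≢0 n≡0 = ℕP.<⇒≢ 0<n (sym (ℤP.+-injective n≡0))

proportional⇒cross : ∀ u v → Proportional u v → v ≢ zeroV → proj₁ u * proj₂ v ≡ proj₂ u * proj₁ v
proportional⇒cross (ux , uy) (vx , vy) (l , m , nontrivial , eq) v≢0 with l ℤ.≟ + 0
... | yes refl = ⊥-elim (v≢0 (cong₂ _,_ (cancel ux vx (cong proj₁ eq)) (cancel uy vy (cong proj₂ eq))))
  where
  m≢0 : m ≢ + 0
  m≢0 = Sum.[ (λ 0≢0 → ⊥-elim (0≢0 refl)) , id ] nontrivial
  cancel : ∀ u v → + 0 * u ≡ m * v → v ≡ + 0
  cancel u v 0≡mv = *-≡0⇒≡0 m v m≢0 (trans (sym 0≡mv) (ℤP.*-zeroˡ u))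
... | no l≢0 = ℤP.*-cancelˡ-≡ l _ _ {{ℤ.≢-nonZero l≢0}} (begin
  l * (ux * vy)   ≡⟨ assoc l ux vy ⟩
  (l * ux) * vy   ≡⟨ cong (_* vy) (cong proj₁ eq) ⟩
  (m * vx) * vy   ≡⟨ shuffle m vx vy ⟩
  vx * (m * vy)   ≡⟨ cong (vx *_) (sym (cong proj₂ eq)) ⟩
  vx * (l * uy)   ≡⟨ shuffle′ vx l uy ⟩
  l * (uy * vx)   ∎)
  where
  open ≡-Reasoning
  assoc : ∀ l x y → l * (x * y) ≡ (l * x) * y
  assoc = solve-∀
  shuffle : ∀ m x y → (m * x) * y ≡ x * (m * y)
  shuffle = solve-∀
  shuffle′ : ∀ x l y → x * (l * y) ≡ l * (y * x)
  shuffle′ = solve-∀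

primitive-multiple : ∀ {w p k n} → Primitive w → 0 < k → k ℕ.≤ n → (+ n) · p ≡ (+ k) · w → p ≡ w
primitive-multiple {w} {p} {suc k₀} prim 0<k k≤n eq with ℕP.m≤n⇒m<n∨m≡n k≤n
... | inj₁ k<n  = ⊥-elim (prim p (suc k₀) _ 0<k k<n eq)
... | inj₂ refl =
  cong₂ _,_ (ℤP.*-cancelˡ-≡ (+ suc k₀) _ _ (cong proj₁ eq)) (ℤP.*-cancelˡ-≡ (+ suc k₀) _ _ (cong proj₂ eq))

multiple-of-primitive⇒≡± : ∀ {w B} → Primitive w → ∀ z t → (+ B) · z ≡ t · w →
  0 < B → z ≢ zeroV → ∣ t ∣ ℕ.≤ B → z ≡± w
multiple-of-primitive⇒≡± {w} {B} prim z (+ zero)  eq 0<B z≢0 _   = ⊥-elim (z≢0 (·-zero-cancel B 0<B z eq))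
multiple-of-primitive⇒≡± {w} {B} prim z (+ suc t) eq _   _   t≤B = inj₁ (primitive-multiple prim (s≤s z≤n) t≤B eq)
multiple-of-primitive⇒≡± {w} {B} prim z -[1+ t ]  eq _   _   t≤B =
  inj₂ (neg-swap (primitive-multiple prim (s≤s z≤n) t≤B eq′))
  where
  eq′ : (+ B) · neg z ≡ (+ suc t) · w
  eq′ = trans (sym (neg-· (+ B) z)) (trans (cong neg eq) (trans (neg-· -[1+ t ] w) (·-neg -[1+ t ] w)))

proportional-primitive⇒≡± : ∀ {w B} → proj₂ w ≡ + B → 0 < B → Primitive w →
  ∀ z → z ≢ zeroV → ∣ proj₂ z ∣ ℕ.≤ B → Proportional w z → z ≡± w
proportional-primitive⇒≡± {w@(wx , wy)} {B} wy≡B 0<B prim z@(zx , zy) z≢0 ∣zy∣≤B prop =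
  multiple-of-primitive⇒≡± prim z zy (cong₂ _,_ first second) 0<B z≢0 ∣zy∣≤B
  where
  first : + B * zx ≡ zy * wx
  first = trans (cong (_* zx) (sym wy≡B)) (trans (sym (proportional⇒cross w z prop z≢0)) (ℤP.*-comm wx zy))
  second : + B * zy ≡ zy * wy
  second = trans (ℤP.*-comm (+ B) zy) (cong (zy *_) (sym wy≡B))

proportional-primitive⇒≡±ˣ : ∀ {w B} → proj₁ w ≡ + B → 0 < B → Primitive w →
  ∀ z → z ≢ zeroV → ∣ proj₁ z ∣ ℕ.≤ B → Proportional w z → z ≡± w
proportional-primitive⇒≡±ˣ {w} wx≡B 0<B prim z z≢0 ∣zx∣≤B prop =
  act-≡±⁻ σ (proportional-primitive⇒≡± wx≡B 0<B (primitive-act σ w prim) (swapᵥ z) (λ eq → z≢0 (cong swapᵥ eq)) ∣zx∣≤B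
              (proportional-act σ w z prop))
  where
  σ = swap-symmetry 0 0

-- Primitive (2a - 1, 2b) or (2a, 2b - 1) is lonely

2*≡+ : ∀ n → + 2 * + n ≡ + (n ℕ.+ n)
2*≡+ n = trans (sym (ℤP.pos-* 2 n)) (cong +_ (cong (n ℕ.+_) (ℕP.+-identityʳ n)))

primitive-w₁⇒lonely : ∀ {a b S} → 0 < a → 0 < b → IsHalfRect a b S → Primitive (w₁ a b) → LonelyVectorProperty S
primitive-w₁⇒lonely {a} {b} {S} 0<a 0<b halfRect prim =
  unique-class⇒lonely (w₁ a b) (D S) (count±-w₁-D 0<a 0<b halfRect) λ j prop →
    let (z≢0 , _ , ∣zy∣≤) = All.lookup (halfRect-D-nonzero-inBox halfRect) (∈-lookup j) in
    proportional-primitive⇒≡± (2*≡+ b) (ℕP.<-≤-trans 0<b (ℕP.m≤m+n b b)) prim _ z≢0 ∣zy∣≤ prop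

primitive-w₂⇒lonely : ∀ {a b S} → 0 < a → 0 < b → IsHalfRect a b S → Primitive (w₂ a b) → LonelyVectorProperty S
primitive-w₂⇒lonely {a} {b} {S} 0<a 0<b halfRect prim =
  unique-class⇒lonely (w₂ a b) (D S) count±-w₂ λ j prop →
    let (z≢0 , ∣zx∣≤ , _) = All.lookup (halfRect-D-nonzero-inBox halfRect) (∈-lookup j) in
    proportional-primitive⇒≡±ˣ (2*≡+ a) (ℕP.<-≤-trans 0<a (ℕP.m≤m+n a a)) prim _ z≢0 ∣zx∣≤ prop
  where
  σ = swap-symmetry a b
  count±-w₂ : count± (w₂ a b) (D S) ≡ 1
  count±-w₂ = trans (sym (count±-D-map σ (w₂ a b) S)) (count±-w₁-D 0<b 0<a (halfRect-map σ S halfRect))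

-- Lonely vectors

inBox⇒count±-D-pos : ∀ {a b S} → 0 < a → 0 < b → IsHalfRect a b S → ∀ r → InBox a b r → r ≢ zeroV →
  1 ℕ.≤ count± r (D S)
inBox⇒count±-D-pos {a} {b} 0<a 0<b halfRect (x , y) (∣x∣≤ , ∣y∣≤) r≢0 with x ℤ.≟ + 0 | y ℤ.≟ + 0
... | yes refl | yes refl = ⊥-elim (r≢0 refl)
... | no x≢0   | no y≢0   =
  decomposition⇒count±-D-pos halfRect
    (inBox⇒rectPoint (x , + 0) (∣x∣≤ , z≤n) (x≢0 ∘ cong proj₁))
    (inBox⇒rectPoint (+ 0 , y) (z≤n , ∣y∣≤) (y≢0 ∘ cong proj₂))
    (cong₂ _,_ (ℤP.+-identityʳ x) (ℤP.+-identityˡ y)) (disjoint± _ _ (x≢0 ∘ cong proj₁) (x≢0 ∘ cong proj₁))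
... | no x≢0   | yes refl =
  decomposition⇒count±-D-pos halfRect
    (inBox⇒rectPoint (x , + 1) (∣x∣≤ , 0<b) (x≢0 ∘ cong proj₁)) (inBox⇒rectPoint (+ 0 , -[1+ 0 ]) (z≤n , 0<b) (λ ()))
    (cong₂ _,_ (ℤP.+-identityʳ x) refl) (disjoint± _ _ (x≢0 ∘ cong proj₁) (x≢0 ∘ cong proj₁))
... | yes refl | no y≢0   =
  decomposition⇒count±-D-pos halfRect
    (inBox⇒rectPoint (+ 1 , y) (0<a , ∣y∣≤) (λ ())) (inBox⇒rectPoint (-[1+ 0 ] , + 0) (0<a , z≤n) (λ ()))
    (cong₂ _,_ refl (ℤP.+-identityʳ y)) (disjoint± _ _ (λ ()) (y≢0 ∘ cong proj₂))

≡±-sym : ∀ {v c} → v ≡± c → c ≡± v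
≡±-sym         (inj₁ refl) = inj₁ refl
≡±-sym {v} {c} (inj₂ refl) = inj₂ (sym (neg-involutive c))

∣∣-≡± : ∀ {v c} → v ≡± c → ∣ proj₁ v ∣ ≡ ∣ proj₁ c ∣ × ∣ proj₂ v ∣ ≡ ∣ proj₂ c ∣
∣∣-≡±     (inj₁ refl) = refl , refl
∣∣-≡± {c = c} (inj₂ refl) = ℤP.∣-i∣≡∣i∣ (proj₁ c) , ℤP.∣-i∣≡∣i∣ (proj₂ c)

·-zeroʳ : ∀ c → c · zeroV ≡ zeroV
·-zeroʳ c = cong₂ _,_ (ℤP.*-zeroʳ c) (ℤP.*-zeroʳ c)

+-double-cancel-≤ : ∀ {m n} → m ℕ.+ m ℕ.≤ n ℕ.+ n → m ℕ.≤ n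
+-double-cancel-≤ 2m≤2n = ℕP.≮⇒≥ λ n<m → ℕP.<⇒≱ (ℕP.+-mono-< n<m n<m) 2m≤2n

half-fraction-≤ : ∀ A n k R Z → 0 < n → k ℕ.+ k ℕ.≤ n → Z ℕ.≤ A ℕ.+ A → n ℕ.* R ≡ k ℕ.* Z → R ℕ.≤ A
half-fraction-≤ A n k R Z 0<n 2k≤n Z≤2A nR≡kZ =
  +-double-cancel-≤ (ℕP.*-cancelˡ-≤ n {{ℕ.>-nonZero 0<n}} (begin
    n ℕ.* (R ℕ.+ R)          ≡⟨ ℕP.*-distribˡ-+ n R R ⟩
    n ℕ.* R ℕ.+ n ℕ.* R      ≡⟨ cong₂ ℕ._+_ nR≡kZ nR≡kZ ⟩
    k ℕ.* Z ℕ.+ k ℕ.* Z      ≡⟨ sym (ℕP.*-distribʳ-+ Z k k) ⟩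
    (k ℕ.+ k) ℕ.* Z          ≤⟨ ℕP.*-monoˡ-≤ Z 2k≤n ⟩
    n ℕ.* Z                  ≤⟨ ℕP.*-monoʳ-≤ n Z≤2A ⟩
    n ℕ.* (A ℕ.+ A)          ∎))
  where open ℕP.≤-Reasoning

∣·∣ : ∀ n x → ∣ + n * x ∣ ≡ n ℕ.* ∣ x ∣
∣·∣ n x = ℤP.abs-* (+ n) x

half-fraction-inBox : ∀ {a b n k} r z → 0 < n → k ℕ.+ k ℕ.≤ n → InBox (a ℕ.+ a) (b ℕ.+ b) z →
  (+ n) · r ≡ (+ k) · z → InBox a b r
half-fraction-inBox {a} {b} {n} {k} (x , y) (zx , zy) 0<n 2k≤n (∣zx∣≤ , ∣zy∣≤) eq =
  half-fraction-≤ a n k (∣ x ∣) (∣ zx ∣) 0<n 2k≤n ∣zx∣≤ (abs-eq (cong proj₁ eq)) ,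
  half-fraction-≤ b n k (∣ y ∣) (∣ zy ∣) 0<n 2k≤n ∣zy∣≤ (abs-eq (cong proj₂ eq))
  where
  abs-eq : ∀ {x z} → + n * x ≡ + k * z → n ℕ.* ∣ x ∣ ≡ k ℕ.* ∣ z ∣
  abs-eq {x} {z} e = trans (sym (∣·∣ n x)) (trans (cong ∣_∣ e) (∣·∣ k z))

*-cancelʳ-≢ : ∀ n k t → n ≢ k → n ℕ.* t ≡ k ℕ.* t → t ≡ 0
*-cancelʳ-≢ n k zero    _   _  = refl
*-cancelʳ-≢ n k (suc t) n≢k eq = ⊥-elim (n≢k (ℕP.*-cancelʳ-≡ n k (suc t) eq))

multiple-≡±⇒zero : ∀ {n k} r z → n ≢ k → (+ n) · r ≡ (+ k) · z → r ≡± z → z ≡ zeroV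
multiple-≡±⇒zero {n} {k} (x , y) (zx , zy) n≢k eq r≡±z =
  ∣∣≡0⇒zero (zx , zy) (coordinate (cong proj₁ eq) (proj₁ (∣∣-≡± r≡±z)))
                      (coordinate (cong proj₂ eq) (proj₂ (∣∣-≡± r≡±z)))
  where
  coordinate : ∀ {x z} → + n * x ≡ + k * z → ∣ x ∣ ≡ ∣ z ∣ → ∣ z ∣ ≡ 0
  coordinate {x} {z} e ∣x∣≡∣z∣ = *-cancelʳ-≢ n k ∣ z ∣ n≢k (begin
    n ℕ.* ∣ z ∣     ≡⟨ cong (n ℕ.*_) (sym ∣x∣≡∣z∣) ⟩
    n ℕ.* ∣ x ∣     ≡⟨ sym (∣·∣ n x) ⟩
    ∣ + n * x ∣     ≡⟨ cong ∣_∣ e ⟩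
    ∣ + k * z ∣     ≡⟨ ∣·∣ k z ⟩
    k ℕ.* ∣ z ∣     ∎)
    where open ≡-Reasoning

complement-multiple : ∀ {n k} p z → k ℕ.≤ n → (+ n) · p ≡ (+ k) · z → (+ n) · (z ⊖ p) ≡ (+ (n ℕ.∸ k)) · z
complement-multiple {n} {k} (px , py) (zx , zy) k≤n eq =
  cong₂ _,_ (coordinate (cong proj₁ eq)) (coordinate (cong proj₂ eq))
  where
  coordinate : ∀ {p x} → + n * p ≡ + k * x → + n * (x - p) ≡ + (n ℕ.∸ k) * x
  coordinate {p} {x} e = begin
    + n * (x - p)          ≡⟨ distrib (+ n) x p ⟩
    + n * x - + n * p      ≡⟨ cong (λ t → + n * x - t) e ⟩
    + n * x - + k * x      ≡⟨ factor (+ n) (+ k) x ⟩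
    (+ n - + k) * x        ≡⟨ cong (_* x) (trans (ℤP.[+m]-[+n]≡m⊖n n k) (ℤP.⊖-≥ k≤n)) ⟩
    + (n ℕ.∸ k) * x        ∎
    where
    open ≡-Reasoning
    distrib : ∀ n x p → n * (x - p) ≡ n * x - n * p
    distrib = solve-∀
    factor : ∀ n k x → n * x - k * x ≡ (n - k) * x
    factor = solve-∀

complement-≤-half : ∀ {n k} → k ℕ.≤ n → ¬ k ℕ.+ k ℕ.≤ n → (n ℕ.∸ k) ℕ.+ (n ℕ.∸ k) ℕ.≤ n
complement-≤-half {n} {k} k≤n 2k≰n = begin
  (n ℕ.∸ k) ℕ.+ (n ℕ.∸ k)   ≤⟨ ℕP.+-monoʳ-≤ (n ℕ.∸ k) n-k≤k ⟩
  (n ℕ.∸ k) ℕ.+ k           ≡⟨ ℕP.m∸n+n≡m k≤n ⟩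
  n                         ∎
  where
  open ℕP.≤-Reasoning
  n-k≤k : n ℕ.∸ k ℕ.≤ k
  n-k≤k = subst (n ℕ.∸ k ℕ.≤_) (ℕP.m+n∸n≡m k k) (ℕP.∸-monoˡ-≤ k (ℕP.<⇒≤ (ℕP.≰⇒> 2k≰n)))

module _ {a b S} (0<a : 0 < a) (0<b : 0 < b) (halfRect : IsHalfRect a b S)
         (i : Fin (length (D S))) (lonely : IsLonely (D S) i) where

  private
    z : V
    z = lookup (D S) i
    z≢0 : z ≢ zeroV
    z≢0 = proj₁ (All.lookup (halfRect-D-nonzero-inBox halfRect) (∈-lookup i))
    z∈ : InBox (a ℕ.+ a) (b ℕ.+ b) z
    z∈ = proj₂ (All.lookup (halfRect-D-nonzero-inBox halfRect) (∈-lookup i))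

  -- r would be a vector of the box, hence of D(S) up to sign, proportional to z
  lonely⇒no-half-multiple : ∀ r n k → 0 < k → k ℕ.+ k ℕ.≤ n → ¬ (+ n) · r ≡ (+ k) · lookup (D S) i
  lonely⇒no-half-multiple r n k 0<k 2k≤n eq =
    lonely⇒proportional-class-absent (D S) i lonely r
      (λ z≡±r → z≢0 (multiple-≡±⇒zero r z n≢k eq (≡±-sym z≡±r)))
      (+ k , + n , inj₁ (λ k≡0 → ℕP.<⇒≢ 0<k (sym (ℤP.+-injective k≡0))) , sym eq)
      (inBox⇒count±-D-pos 0<a 0<b halfRect r (half-fraction-inBox {n = n} {k} r z 0<n 2k≤n z∈ eq) r≢0)
    where
    0<n : 0 < n
    0<n = ℕP.<-≤-trans 0<k (ℕP.≤-trans (ℕP.m≤m+n k k) 2k≤n)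
    n≢k : n ≢ k
    n≢k refl = ℕP.<⇒≱ (ℕP.m<m+n k 0<k) 2k≤n
    r≢0 : r ≢ zeroV
    r≢0 refl = z≢0 (·-zero-cancel k 0<k z (trans (sym eq) (·-zeroʳ (+ n))))

  lonely⇒primitive : Primitive (lookup (D S) i)
  lonely⇒primitive p k n 0<k k<n eq with k ℕ.+ k ℕ.≤? n
  ... | yes 2k≤n = lonely⇒no-half-multiple p n k 0<k 2k≤n eq
  ... | no 2k≰n  = lonely⇒no-half-multiple (z ⊖ p) n (n ℕ.∸ k) (ℕP.m<n⇒0<n∸m k<n)
                     (complement-≤-half (ℕP.<⇒≤ k<n) 2k≰n) (complement-multiple p z (ℕP.<⇒≤ k<n) eq)

  -- z or -z is in S, so 2z or -2z is in D(S)
  lonely⇒∉box : ¬ InBox a b (lookup (D S) i)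
  lonely⇒∉box z∈box =
    lonely⇒proportional-class-absent (D S) i lonely (2z)
      (λ z≡±2z → double-nonzero z z≢0 (multiple-≡±⇒zero {2} {1} z 2z (λ ()) (sym (·-identityˡ 2z)) z≡±2z))
      (+ 2 , + 1 , inj₁ (λ ()) , sym (·-identityˡ 2z))
      (ℕP.≤-trans double-in-S (doubleHits≤count±-D 2z S))
    where
    2z = (+ 2) · z
    hit : ∀ {u} → u ∈ S → (+ 2) · u ≡± 2z → 1 ℕ.≤ sumBy (doubleHit 2z) S
    hit {u} u∈S 2u≡±2z = ℕP.≤-trans (ℕP.≤-reflexive (sym (indicator-yes _ 2u≡±2z))) (≤-sumBy (doubleHit 2z) S u∈S)
    double-in-S : 1 ℕ.≤ sumBy (doubleHit 2z) S
    double-in-S with proj₁ (proj₂ (proj₂ halfRect)) z (inBox⇒inRect z z∈box) z≢0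
    ... | inj₁ z∈S  = hit z∈S (inj₁ refl)
    ... | inj₂ -z∈S = hit -z∈S (inj₂ (sym (neg-· (+ 2) z)))

PositiveX : V → Set
PositiveX v = Σ ℕ λ k → proj₁ v ≡ + suc k

positiveX⇒nonzero : ∀ v → PositiveX v → v ≢ zeroV
positiveX⇒nonzero (.(+ suc k) , y) (k , refl) ()

positiveX⇒≢neg : ∀ u v → PositiveX u → PositiveX v → u ≢ neg v
positiveX⇒≢neg (.(+ suc k) , y) (.(+ suc k') , y') (k , refl) (k' , refl) ()

positiveX-disjoint± : ∀ {p q} → PositiveX p → PositiveX q → p ≢ q → Disjoint± p q
positiveX-disjoint± {p} {q} p⁺ q⁺ p≢q = disjoint± p q p≢q (positiveX⇒≢neg p q p⁺ q⁺)

primitive⇒summands-≢ : ∀ {p q} → Primitive (p ⊕ q) → p ≢ q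
primitive⇒summands-≢ {p} prim refl =
  prim p 1 2 (s≤s z≤n) (s≤s (s≤s z≤n)) (trans (sym (⊕-self p)) (sym (·-identityˡ (p ⊕ p))))

PositiveRectPoint : ℕ → ℕ → V → Set
PositiveRectPoint a b v = InRect a b v × PositiveX v

two-positive-decompositions⇒count±-D≥2 : ∀ {a b S p q p' q'} → IsHalfRect a b S → Primitive (p ⊕ q) →
  PositiveRectPoint a b p → PositiveRectPoint a b q → PositiveRectPoint a b p' → PositiveRectPoint a b q' →
  p' ⊕ q' ≡ p ⊕ q → p ≢ p' → p ≢ q' → q ≢ p' → q ≢ q' → 2 ℕ.≤ count± (p ⊕ q) (D S)
two-positive-decompositions⇒count±-D≥2 {p = p} {q} {p'} {q'} halfRect prim
  (p∈ , p⁺) (q∈ , q⁺) (p'∈ , p'⁺) (q'∈ , q'⁺) p'+q'≡z p≢p' p≢q' q≢p' q≢q' =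
  two-decompositions⇒count±-D≥2 halfRect
    (p∈ , positiveX⇒nonzero p p⁺) (q∈ , positiveX⇒nonzero q q⁺)
    (p'∈ , positiveX⇒nonzero p' p'⁺) (q'∈ , positiveX⇒nonzero q' q'⁺)
    refl p'+q'≡z (positiveX-disjoint± p⁺ q⁺ (primitive⇒summands-≢ prim))
    (positiveX-disjoint± p'⁺ q'⁺ (primitive⇒summands-≢ (subst Primitive (sym p'+q'≡z) prim)))
    disjointPairs
  where
  disjointPairs : DisjointPairs p q p' q'
  disjointPairs v (inj₁ v≡±p) (inj₁ v≡±p') = positiveX-disjoint± p⁺ p'⁺ p≢p' v v≡±p v≡±p'
  disjointPairs v (inj₁ v≡±p) (inj₂ v≡±q') = positiveX-disjoint± p⁺ q'⁺ p≢q' v v≡±p v≡±q'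
  disjointPairs v (inj₂ v≡±q) (inj₁ v≡±p') = positiveX-disjoint± q⁺ p'⁺ q≢p' v v≡±q v≡±p'
  disjointPairs v (inj₂ v≡±q) (inj₂ v≡±q') = positiveX-disjoint± q⁺ q'⁺ q≢q' v v≡±q v≡±q'

n≢1+n : ∀ n → n ≢ suc n
n≢1+n n eq = ℕP.<-irrefl eq (ℕP.n<1+n n)

∣n-b∣≤b : ∀ n b → n ℕ.≤ b ℕ.+ b → ∣ + n - + b ∣ ℕ.≤ b
∣n-b∣≤b n b n≤2b rewrite ℤP.[+m]-[+n]≡m⊖n n b with b ℕ.≤? n
... | yes b≤n = subst (ℕ._≤ b) (sym (trans (ℤP.∣m⊖n∣≡∣n⊖m∣ n b) (ℤP.∣⊖∣-≤ b≤n)))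
                  (subst (n ℕ.∸ b ℕ.≤_) (ℕP.m+n∸n≡m b b) (ℕP.∸-monoˡ-≤ b n≤2b))
... | no b≰n  = subst (ℕ._≤ b) (sym (ℤP.∣⊖∣-< (ℕP.≰⇒> b≰n))) (ℕP.m∸n≤m b n)

n-b+b≡n : ∀ n b → (+ n - + b) + + b ≡ + n
n-b+b≡n n b = cancel (+ n) (+ b)
  where
  cancel : ∀ n b → (n - b) + b ≡ n
  cancel = solve-∀

n-b≡c⇒n≡c+b : ∀ {n b c} → + n - + b ≡ + c → n ≡ c ℕ.+ b
n-b≡c⇒n≡c+b {n} {b} eq = ℤP.+-injective (trans (sym (n-b+b≡n n b)) (cong (_+ + b) eq))

w₁-coordinates : ∀ a b m n → suc m ≡ a ℕ.+ a → n ≡ b ℕ.+ b → (+ m , + n) ≡ w₁ a b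
w₁-coordinates a b m n 1+m≡2a n≡2b = cong₂ _,_
  (sym (trans (cong (_- + 1) (trans (2*≡+ a) (cong +_ (sym 1+m≡2a)))) (pred-suc (+ m))))
  (trans (cong +_ n≡2b) (sym (2*≡+ b)))
  where
  pred-suc : ∀ m → (+ 1 + m) - + 1 ≡ m
  pred-suc = solve-∀

w₂-coordinates : ∀ a b m n → m ≡ a ℕ.+ a → suc n ≡ b ℕ.+ b → (+ m , + n) ≡ w₂ a b
w₂-coordinates a b m n m≡2a 1+n≡2b = cong swapᵥ (w₁-coordinates b a n m 1+n≡2b m≡2a)

-- (m, n) = (m - a, n - b) + (a, b) = (m - a + 1, n - b) + (a - 1, b),
-- two different splittings unless (m, n) = (2a - 1, 2b)
x-shift-case : ∀ a₁ b o n {S} → IsHalfRect (suc (suc a₁)) b S → suc (suc o) ℕ.≤ suc (suc a₁) → n ℕ.≤ b ℕ.+ b →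
  Primitive (+ suc (suc (suc a₁) ℕ.+ o) , + n) →
  (+ suc (suc (suc a₁) ℕ.+ o) , + n) ≡ w₁ (suc (suc a₁)) b ⊎ 2 ℕ.≤ count± (+ suc (suc (suc a₁) ℕ.+ o) , + n) (D S)
x-shift-case a₁ b o n {S} halfRect o+2≤a n≤2b prim = cases (p' ≟ᵥ q) (p ≟ᵥ q')
  where
  a = suc (suc a₁)
  z p q p' q' : V
  z  = (+ suc (a ℕ.+ o) , + n)
  p  = (+ suc o , + n - + b)
  q  = (+ a , + b)
  p' = (+ suc (suc o) , + n - + b)
  q' = (+ suc a₁ , + b)
  p+q≡z : p ⊕ q ≡ z
  p+q≡z = cong₂ _,_ (cong (λ t → + suc t) (ℕP.+-comm o a)) (n-b+b≡n n b)
  p'+q'≡p+q : p' ⊕ q' ≡ p ⊕ q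
  p'+q'≡p+q = cong (λ t → (+ suc t , (+ n - + b) + + b)) (sym (ℕP.+-suc o (suc a₁)))
  inRect : ∀ {x} → x ℕ.≤ a → InRect a b (+ x , + n - + b)
  inRect x≤a = inBox⇒inRect _ (x≤a , ∣n-b∣≤b n b n≤2b)
  exceptional : suc (suc o) ≡ a → n ≡ b ℕ.+ b → z ≡ w₁ a b
  exceptional o+2≡a n≡2b = w₁-coordinates a b (suc (a ℕ.+ o)) n
    (trans (cong suc (sym (ℕP.+-suc a o))) (trans (sym (ℕP.+-suc a (suc o))) (cong (a ℕ.+_) o+2≡a))) n≡2b
  cases : Dec (p' ≡ q) → Dec (p ≡ q') → z ≡ w₁ a b ⊎ 2 ℕ.≤ count± z (D S)
  cases (yes p'≡q) _ = inj₁ (exceptional (ℤP.+-injective (cong proj₁ p'≡q)) (n-b≡c⇒n≡c+b (cong proj₂ p'≡q)))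
  cases (no _) (yes p≡q') =
    inj₁ (exceptional (cong suc (ℤP.+-injective (cong proj₁ p≡q'))) (n-b≡c⇒n≡c+b (cong proj₂ p≡q')))
  cases (no p'≢q) (no p≢q') = inj₂ (subst (λ w → 2 ℕ.≤ count± w (D S)) p+q≡z
    (two-positive-decompositions⇒count±-D≥2 halfRect (subst Primitive (sym p+q≡z) prim)
      (inRect (ℕP.≤-trans (ℕP.n≤1+n (suc o)) o+2≤a) , (o , refl))
      (inBox⇒inRect q (ℕP.≤-refl , ℕP.≤-refl) , (suc a₁ , refl))
      (inRect o+2≤a , (suc o , refl))
      (inBox⇒inRect q' (ℕP.n≤1+n (suc a₁) , ℕP.≤-refl) , (a₁ , refl))
      p'+q'≡p+q
      (λ eq → n≢1+n o (ℕP.suc-injective (ℤP.+-injective (cong proj₁ eq))))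
      p≢q' (p'≢q ∘ sym)
      (λ eq → n≢1+n (suc a₁) (sym (ℤP.+-injective (cong proj₁ eq))))))

-- (2a, n) = (a, n - b) + (a, b) = (a, n + 1 - b) + (a, b - 1)
y-shift-case : ∀ a₀ b₀ n {S} → IsHalfRect (suc a₀) (suc b₀) S → suc (suc n) ℕ.≤ suc b₀ ℕ.+ suc b₀ →
  Primitive (+ (suc a₀ ℕ.+ suc a₀) , + n) → 2 ℕ.≤ count± (+ (suc a₀ ℕ.+ suc a₀) , + n) (D S)
y-shift-case a₀ b₀ n {S} halfRect n+2≤2b prim = subst (λ w → 2 ℕ.≤ count± w (D S)) p+q≡z
  (two-positive-decompositions⇒count±-D≥2 halfRect (subst Primitive (sym p+q≡z) prim)
    (inBox⇒inRect p (ℕP.≤-refl , ∣n-b∣≤b n b (ℕP.≤-trans (ℕP.n≤1+n n) n+1≤2b)) , (a₀ , refl))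
    (inBox⇒inRect q (ℕP.≤-refl , ℕP.≤-refl) , (a₀ , refl))
    (inBox⇒inRect p' (ℕP.≤-refl , ∣n-b∣≤b (suc n) b n+1≤2b) , (a₀ , refl))
    (inBox⇒inRect q' (ℕP.≤-refl , ℕP.n≤1+n b₀) , (a₀ , refl))
    p'+q'≡p+q p≢p' p≢q' q≢p' q≢q')
  where
  a = suc a₀
  b = suc b₀
  n+1≤2b : suc n ℕ.≤ b ℕ.+ b
  n+1≤2b = ℕP.≤-trans (ℕP.n≤1+n (suc n)) n+2≤2b
  z p q p' q' : V
  z  = (+ (a ℕ.+ a) , + n)
  p  = (+ a , + n - + b)
  q  = (+ a , + b)
  p' = (+ a , + suc n - + b)
  q' = (+ a , + b₀)
  p+q≡z : p ⊕ q ≡ z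
  p+q≡z = cong (+ (a ℕ.+ a) ,_) (n-b+b≡n n b)
  p'+q'≡p+q : p' ⊕ q' ≡ p ⊕ q
  p'+q'≡p+q = cong (+ (a ℕ.+ a) ,_) (trans (shift (+ n) (+ b₀)) (sym (n-b+b≡n n b)))
    where
    shift : ∀ n b₀ → ((+ 1 + n) - (+ 1 + b₀)) + b₀ ≡ n
    shift = solve-∀
  p≢p' : p ≢ p'
  p≢p' eq = n≢1+n n (ℤP.+-injective (begin
    + n                        ≡⟨ sym (n-b+b≡n n b) ⟩
    (+ n - + b) + + b          ≡⟨ cong (_+ + b) (cong proj₂ eq) ⟩
    (+ suc n - + b) + + b      ≡⟨ n-b+b≡n (suc n) b ⟩
    + suc n                    ∎))
    where open ≡-Reasoning
  q≢q' : q ≢ q'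
  q≢q' eq = n≢1+n b₀ (sym (ℤP.+-injective (cong proj₂ eq)))
  q≢p' : q ≢ p'
  q≢p' eq = ℕP.<-irrefl (n-b≡c⇒n≡c+b (sym (cong proj₂ eq))) n+2≤2b
  p≢q' : p ≢ q'
  p≢q' eq = ℕP.<-irrefl (trans (cong suc (n-b≡c⇒n≡c+b (cong proj₂ eq)))
                               (trans (cong suc (ℕP.+-comm b₀ b)) (sym (ℕP.+-suc b b₀)))) n+2≤2b

Exceptional : ℕ → ℕ → V → Set
Exceptional a b z = z ≡ w₁ a b ⊎ z ≡ w₂ a b

at-2a-cases : ∀ {a₀ b₀ S} → IsHalfRect (suc a₀) (suc b₀) S → ∀ n → n ℕ.≤ suc b₀ ℕ.+ suc b₀ →
  let a = suc a₀ ; b = suc b₀ in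
  Primitive (+ (a ℕ.+ a) , + n) → Exceptional a b (+ (a ℕ.+ a) , + n) ⊎ 2 ℕ.≤ count± (+ (a ℕ.+ a) , + n) (D S)
at-2a-cases {a₀} {b₀} halfRect n n≤2b prim with n ℕ.≟ suc b₀ ℕ.+ suc b₀
... | yes refl = ⊥-elim (prim (+ suc a₀ , + suc b₀) 1 2 (s≤s z≤n) (s≤s (s≤s z≤n))
                   (trans (cong₂ _,_ (2*≡+ (suc a₀)) (2*≡+ (suc b₀))) (sym (·-identityˡ _))))
... | no n≢2b with suc n ℕ.≟ suc b₀ ℕ.+ suc b₀
...   | yes 1+n≡2b = inj₁ (inj₂ (w₂-coordinates (suc a₀) (suc b₀) _ n refl 1+n≡2b))
...   | no 1+n≢2b  = inj₂ (y-shift-case a₀ b₀ n halfRect (ℕP.≤∧≢⇒< (ℕP.≤∧≢⇒< n≤2b n≢2b) 1+n≢2b) prim)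

beyond-a-cases : ∀ {a b S} → 0 < a → 0 < b → IsHalfRect a b S → ∀ m n → a < m → m ℕ.≤ a ℕ.+ a → n ℕ.≤ b ℕ.+ b →
  Primitive (+ m , + n) → Exceptional a b (+ m , + n) ⊎ 2 ℕ.≤ count± (+ m , + n) (D S)
beyond-a-cases {suc a₀} {suc b₀} {S} _ _ halfRect m n a<m m≤2a n≤2b prim with ℕP.m≤n⇒∃[o]m+o≡n a<m
... | o , refl with suc (suc o) ℕ.≤? suc a₀
...   | yes o+2≤a = x-shift a₀ halfRect o+2≤a prim
  where
  x-shift : ∀ a₀ {S} → IsHalfRect (suc a₀) (suc b₀) S → suc (suc o) ℕ.≤ suc a₀ →
    Primitive (+ suc (suc a₀ ℕ.+ o) , + n) →
    Exceptional (suc a₀) (suc b₀) (+ suc (suc a₀ ℕ.+ o) , + n) ⊎ 2 ℕ.≤ count± (+ suc (suc a₀ ℕ.+ o) , + n) (D S)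
  x-shift zero      _         (s≤s ()) _
  x-shift (suc a₁) halfRect′ o+2≤a′ prim′ =
    Sum.map₁ inj₁ (x-shift-case a₁ (suc b₀) o n halfRect′ o+2≤a′ n≤2b prim′)
...   | no o+2≰a = subst (λ m → Exceptional (suc a₀) (suc b₀) (+ m , + n) ⊎ 2 ℕ.≤ count± (+ m , + n) (D S)) (sym m≡2a)
                   (at-2a-cases halfRect n n≤2b (subst (λ m → Primitive (+ m , + n)) m≡2a prim))
  where
  a = suc a₀
  m≡2a : suc a ℕ.+ o ≡ a ℕ.+ a
  m≡2a = trans (sym (ℕP.+-suc a o)) (cong (a ℕ.+_)
    (ℕP.≤-antisym (ℕP.+-cancelˡ-≤ a (suc o) a (subst (ℕ._≤ a ℕ.+ a) (sym (ℕP.+-suc a o)) m≤2a)) (ℕP.≮⇒≥ o+2≰a)))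

exceptional-swap : ∀ {a b v} → Exceptional b a (swapᵥ v) → Exceptional a b v
exceptional-swap (inj₁ eq) = inj₂ (cong swapᵥ eq)
exceptional-swap (inj₂ eq) = inj₁ (cong swapᵥ eq)

-- After changing signs of coordinates, and swapping them if |x| ≤ a, z = (m, n) with m, n ≥ 0 and a < m.
outside-box-cases : ∀ {a b S} → 0 < a → 0 < b → IsHalfRect a b S → ∀ z → Primitive z →
  InBox (a ℕ.+ a) (b ℕ.+ b) z → ¬ InBox a b z → Exceptional a b (absᵥ z) ⊎ 2 ℕ.≤ count± z (D S)
outside-box-cases {a} {b} {S} 0<a 0<b halfRect z prim (M≤2a , N≤2b) z∉ with a ℕ.<? ∣ proj₁ z ∣
... | yes a<M = Sum.map₂ (count±-D≥2-transport σ {S = S} σz≡∣z∣)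
                  (beyond-a-cases 0<a 0<b (halfRect-map σ S halfRect) _ _ a<M M≤2a N≤2b ∣z∣-primitive)
  where
  σ = proj₁ (sign-normalizer a b z)
  σz≡∣z∣ = proj₂ (sign-normalizer a b z)
  ∣z∣-primitive = primitive-absᵥ z prim
... | no a≮M = Sum.map (exceptional-swap {a} {b})
                   (count±-D≥2-transport σ {S = S} σz≡∣z∣ ∘
                    count±-D≥2-transport τ {absᵥ z} {S = map (RectSymmetry.act σ) S} refl)
                 (beyond-a-cases 0<b 0<a (halfRect-map τ _ (halfRect-map σ S halfRect)) _ _ b<N N≤2b M≤2a
                   (primitive-act τ _ (primitive-absᵥ z prim)))
  where
  σ = proj₁ (sign-normalizer a b z)
  σz≡∣z∣ = proj₂ (sign-normalizer a b z)
  τ = swap-symmetry a b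
  b<N : b < ∣ proj₂ z ∣
  b<N = ℕP.≰⇒> λ N≤b → z∉ (ℕP.≮⇒≥ a≮M , N≤b)

exceptional-primitive : ∀ {a b v} → Primitive v → Exceptional a b v → Primitive (w₁ a b) ⊎ Primitive (w₂ a b)
exceptional-primitive prim = Sum.map (λ v≡w₁ → subst Primitive v≡w₁ prim) (λ v≡w₂ → subst Primitive v≡w₂ prim)

lonely⇒primitive-w : ∀ {a b S} → 0 < a → 0 < b → IsHalfRect a b S → LonelyVectorProperty S →
  Primitive (w₁ a b) ⊎ Primitive (w₂ a b)
lonely⇒primitive-w {a} {b} {S} 0<a 0<b halfRect (i , lonely) =
  Sum.[ exceptional-primitive {a} {b} (primitive-absᵥ z z-primitive)
      , (λ two≤ → ⊥-elim (lonely⇒count±<2 (D S) i lonely two≤)) ]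
    (outside-box-cases 0<a 0<b halfRect z z-primitive z∈ (lonely⇒∉box 0<a 0<b halfRect i lonely))
  where
  z = lookup (D S) i
  z-primitive = lonely⇒primitive 0<a 0<b halfRect i lonely
  z∈ = proj₂ (All.lookup (halfRect-D-nonzero-inBox halfRect) (∈-lookup i))

proposition4p10 : (a b : ℕ) → 0 < a → 0 < b → (S : List V) → IsHalfRect a b S →
    LonelyVectorProperty S ⇔
      (Primitive ((+ 2 * + a - + 1) , (+ 2 * + b)) ⊎ Primitive ((+ 2 * + a) , (+ 2 * + b - + 1)))
proposition4p10 a b 0<a 0<b S halfRect = mk⇔
  (lonely⇒primitive-w 0<a 0<b halfRect)
  Sum.[ primitive-w₁⇒lonely 0<a 0<b halfRect , primitive-w₂⇒lonely 0<a 0<b halfRect ]
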